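{- Let $\ell$ be a prime and $0<|q|<1$. Define $$\overline{S}_2(b):=\sum_{\substack{n\in\mathbb{Z}\\ n\neq 0}}\frac{(-1)^nq^{n^2+2bn}}{1-q^{2\ell n}}.$$ Then $$\overline{S}_2(\ell)=\frac{ -(q)_\infty}{2(-q)_\infty}+\frac12 .$$
   Context: $(a;q)_\infty=\prod_{k\ge0}(1-aq^k)$, $(q)_\infty=(q;q)_\infty$, $(-q)_\infty=(-q;q)_\infty$. -}

module Defs where

open import Data.Nat as ℕ using (ℕ; zero; suc; _∸_; _≡ᵇ_)
open import Data.Integer as ℤ using (ℤ; +_; -_; _+_; _*_)
open import Data.List using (List; []; _∷_; map; upTo)
open import Data.Bool using (Bool; true; false; if_then_else_)
open import Data.Integer.Properties using (_≟_)
open import Relation.Nullary.Decidable using (⌊_⌋)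

sum : List ℤ → ℤ
sum []       = + 0
sum (x ∷ xs) = x + sum xs

FPS : Set
FPS = ℕ → ℤ

one : FPS
one zero    = + 1
one (suc _) = + 0

mul : FPS → FPS → FPS
mul f g N = sum (map (λ k → f k * g (N ∸ k)) (upTo (suc N)))

factor : ℤ → ℕ → FPS
factor c k N = if N ≡ᵇ suc k then - c else (if N ≡ᵇ 0 then + 1 else + 0)

prodFin : ℤ → ℕ → FPS
prodFin c zero    = one
prodFin c (suc K) = mul (prodFin c K) (factor c K)

-- (c q; q)_∞ = ∏_{k ≥ 0} (1 - c q^(k+1)); the coefficient of q^N only
-- depends on the factors with k < N, so it is read off a finite product.
poch : ℤ → FPS
poch c N = prodFin c (suc N) N

qPoch : FPS
qPoch = poch (+ 1)

mqPoch : FPS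
mqPoch = poch (- (+ 1))

-- Multiplicative inverse of a power series f with f 0 = 1.
-- invRev f N = [g_N, g_(N-1), ..., g_0] where g = 1/f, computed by
-- g_0 = 1, g_(N+1) = - Σ_{k=1}^{N+1} f k * g_(N+1-k).
dotRev : FPS → ℕ → List ℤ → ℤ
dotRev f i []       = + 0
dotRev f i (x ∷ xs) = f (suc i) * x + dotRev f (suc i) xs

invRev : FPS → ℕ → List ℤ
invRev f zero    = + 1 ∷ []
invRev f (suc N) = let gs = invRev f N in (- dotRev f 0 gs) ∷ gs

headOr0 : List ℤ → ℤ
headOr0 []      = + 0
headOr0 (x ∷ _) = x

inv : FPS → FPS
inv f N = headOr0 (invRev f N)

-- Coefficient of q^E in the expansion, valid for |q| < 1, of
--   S̄₂(b) = Σ_{n ∈ ℤ, n ≠ 0} (-1)^n q^(n² + 2bn) / (1 - q^(2ℓn)).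
-- For n > 0:  1/(1-q^(2ℓn)) = Σ_{j≥0} q^(2ℓnj).
-- For n = -m < 0:  1/(1-q^(-2ℓm)) = - Σ_{j≥1} q^(2ℓmj).
-- So the n>0 term contributes (-1)^n to exponents n² + 2bn + 2ℓnj (j ≥ 0),
-- and the n=-m term contributes -(-1)^m to exponents m² - 2bm + 2ℓmj (j ≥ 1).
-- For 0 ≤ b ≤ ℓ all exponents are ≥ 0 and every (n,j) resp. (m,j) producing
-- exponent E has n, m, j ≤ E + 1, so the finite search below is exact.
sgn : ℕ → ℤ
sgn n = if n ℕ.% 2 ≡ᵇ 0 then + 1 else - (+ 1)

range : ℕ → List ℕ
range E = upTo (suc (suc E))

hit : ℤ → ℕ → ℤ → ℤ
hit e E c = if ⌊ e ≟ + E ⌋ then c else + 0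

posPart : ℕ → ℕ → ℕ → ℤ
posPart ℓ b E =
  sum (map (λ n → sum (map (λ j →
    hit (+ (n ℕ.* n ℕ.+ 2 ℕ.* b ℕ.* n ℕ.+ 2 ℕ.* ℓ ℕ.* n ℕ.* j)) E (sgn n))
    (range E))) (map suc (range E)))

negPart : ℕ → ℕ → ℕ → ℤ
negPart ℓ b E =
  sum (map (λ m → sum (map (λ j →
    hit (+ (m ℕ.* m) ℤ.- + (2 ℕ.* b ℕ.* m) + + (2 ℕ.* ℓ ℕ.* m ℕ.* j)) E (- sgn m))
    (map suc (range E)))) (map suc (range E)))

S2bar : ℕ → ℕ → FPS
S2bar ℓ b E = posPart ℓ b E + negPart ℓ b E

-- For n > 0 the two geometric series making up the n-th term of S̄₂(ℓ) differ by one term,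
-- so they telescope to −(−1)ⁿ q^(n²) and 2 S̄₂(ℓ) = 1 − θ with θ = Σ_{n ∈ ℤ} (−1)ⁿ q^(n²).
-- Gauss' identity θ = (q)_∞/(−q)_∞ comes from the finite Jacobi triple product
--   ∏_{k<a} (z + q^(2k+1)) ∏_{k<b} (1 + z q^(2k+1)) = Σⱼ q^((j−a)²) [a+b choose j]_{q²} zʲ
-- at z = −1 and a = b = n. Modulo q^(2n+1) each term q^((j−n)²) [2n choose j]_{q²} (q²;q²)_{2n}
-- is just q^((j−n)²), so (q;q²)ₙ² (q²;q²)ₙ ≡ θ; with (q)_{2n} = (q;q²)ₙ (q²;q²)ₙ and
-- (−q)_{2n} (q)_{2n} = (q²;q²)_{2n} this gives (−q)_{2n} θ ≡ (q)_{2n} modulo q^(2n+1).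
module Submission where

open import Defs
open import Data.Nat as ℕ using (ℕ; zero; suc; _≤_; _<_; z≤n; s≤s; _≡ᵇ_)
import Data.Nat.Properties as ℕP
open import Data.Nat.Primality using (Prime; prime⇒nonTrivial)
open import Data.Nat.Base using (nonTrivial⇒n>1)
open import Data.Nat.Tactic.RingSolver using () renaming (solve-∀ to ℕ-solve-∀)
open import Data.Integer as ℤ using (ℤ; +_; -_; _+_; _*_)
import Data.Integer.Properties as ℤP
open import Data.Integer.Tactic.RingSolver using () renaming (solve-∀ to ℤ-solve-∀)
open import Data.Bool using (true; false; if_then_else_; T)
open import Data.List using (map; upTo; applyUpTo)
open import Data.List.Properties using (map-applyUpTo; map-upTo)
open import Data.Maybe using (Maybe; just; nothing)
open import Data.Product using (_,_; _×_; proj₁; ∃)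
open import Data.Sum using (inj₁; inj₂)
open import Function using (_∘_)
open import Level using (0ℓ)
open import Relation.Binary using (Setoid)
open import Relation.Binary.PropositionalEquality
  using (_≡_; refl; sym; trans; cong; cong₂; subst; module ≡-Reasoning)
open import Relation.Nullary using (yes; no)
open import Relation.Nullary.Decidable using (⌊_⌋)
open import Data.Empty using (⊥-elim)
open import Data.Unit using (tt)
open import Data.Nat.DivMod using (_%_; [m+n]%n≡m%n)
open import Algebra.Bundles using (CommutativeRing)
open import Algebra.Structures using (IsCommutativeRing)
open import Algebra.Solver.Ring.AlmostCommutativeRing
  using (fromCommutativeRing; _-Raw-AlmostCommutative⟶_)
import Algebra.Solver.Ring
open import Algebra.Properties.CommutativeSemigroup ℤP.+-commutativeSemigroup
  using () renaming (interchange to +-interchange)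

infix  4 _≋_
infixl 6 _⊕_
infixl 7 _⊛_
infix  8 ⊝_

_≋_ : FPS → FPS → Set
f ≋ g = ∀ n → f n ≡ g n

_⊕_ : FPS → FPS → FPS
(f ⊕ g) n = f n + g n

⊝_ : FPS → FPS
(⊝ f) n = - f n

ι : ℤ → FPS
ι c zero    = c
ι c (suc _) = + 0

𝟘 𝟙 : FPS
𝟘 _ = + 0
𝟙 = ι (+ 1)

tail : FPS → FPS
tail f n = f (suc n)

_⊛_ : FPS → FPS → FPS
(f ⊛ g) zero    = f 0 * g 0
(f ⊛ g) (suc n) = f 0 * g (suc n) + (tail f ⊛ g) n

_·_ : ℤ → FPS → FPS
(c · f) n = c * f n

≋-refl : ∀ {f} → f ≋ f
≋-refl n = refl

≋-sym : ∀ {f g} → f ≋ g → g ≋ f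
≋-sym p n = sym (p n)

≋-trans : ∀ {f g h} → f ≋ g → g ≋ h → f ≋ h
≋-trans p q n = trans (p n) (q n)

≋-reflexive : ∀ {f g} → f ≡ g → f ≋ g
≋-reflexive refl = ≋-refl

⊕-cong : ∀ {f f′ g g′} → f ≋ f′ → g ≋ g′ → f ⊕ g ≋ f′ ⊕ g′
⊕-cong p q n = cong₂ _+_ (p n) (q n)

⊕-congˡ : ∀ f {g g′} → g ≋ g′ → f ⊕ g ≋ f ⊕ g′
⊕-congˡ f = ⊕-cong (≋-refl {f})

⊕-congʳ : ∀ g {f f′} → f ≋ f′ → f ⊕ g ≋ f′ ⊕ g
⊕-congʳ g f≋f′ = ⊕-cong f≋f′ (≋-refl {g})

⊝-cong : ∀ {f f′} → f ≋ f′ → ⊝ f ≋ ⊝ f′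
⊝-cong p n = cong -_ (p n)

⊛-cong : ∀ {f f′ g g′} → f ≋ f′ → g ≋ g′ → f ⊛ g ≋ f′ ⊛ g′
⊛-cong p q zero    = cong₂ _*_ (p 0) (q 0)
⊛-cong p q (suc n) = cong₂ _+_ (cong₂ _*_ (p 0) (q (suc n))) (⊛-cong (p ∘ suc) q n)

⊛-congˡ : ∀ f {g g′} → g ≋ g′ → f ⊛ g ≋ f ⊛ g′
⊛-congˡ f = ⊛-cong (≋-refl {f})

⊛-congʳ : ∀ g {f f′} → f ≋ f′ → f ⊛ g ≋ f′ ⊛ g
⊛-congʳ g f≋f′ = ⊛-cong f≋f′ (≋-refl {g})

⊛-distribʳ : ∀ h f g → (f ⊕ g) ⊛ h ≋ f ⊛ h ⊕ g ⊛ h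
⊛-distribʳ h f g zero    = ℤP.*-distribʳ-+ (h 0) (f 0) (g 0)
⊛-distribʳ h f g (suc n) = begin
  (f 0 + g 0) * h (suc n) + ((tail f ⊕ tail g) ⊛ h) n
    ≡⟨ cong₂ _+_ (ℤP.*-distribʳ-+ (h (suc n)) (f 0) (g 0)) (⊛-distribʳ h (tail f) (tail g) n) ⟩
  (f 0 * h (suc n) + g 0 * h (suc n)) + ((tail f ⊛ h) n + (tail g ⊛ h) n)
    ≡⟨ +-interchange (f 0 * h (suc n)) (g 0 * h (suc n)) ((tail f ⊛ h) n) ((tail g ⊛ h) n) ⟩
  (f 0 * h (suc n) + (tail f ⊛ h) n) + (g 0 * h (suc n) + (tail g ⊛ h) n) ∎
  where open ≡-Reasoning

⊛-·-assoc : ∀ c f g → (c · f) ⊛ g ≋ c · (f ⊛ g)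
⊛-·-assoc c f g zero    = ℤP.*-assoc c (f 0) (g 0)
⊛-·-assoc c f g (suc n) =
  trans (cong₂ _+_ (ℤP.*-assoc c (f 0) (g (suc n))) (⊛-·-assoc c (tail f) g n))
        (sym (ℤP.*-distribˡ-+ c (f 0 * g (suc n)) ((tail f ⊛ g) n)))

-- Commutativity is proved for the coefficients n and n + 1 simultaneously,
-- since the recursion peels off a factor on the left only.
⊛-comm-upTo : ∀ n → (∀ f g → (f ⊛ g) n ≡ (g ⊛ f) n)
                  × (∀ f g → (f ⊛ g) (suc n) ≡ (g ⊛ f) (suc n))
⊛-comm-upTo zero =
  (λ f g → ℤP.*-comm (f 0) (g 0)) , λ f g → swap (f 0) (g 1) (f 1) (g 0)
  where
  swap : ∀ a b c d → a * b + c * d ≡ d * c + b * a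
  swap = ℤ-solve-∀
⊛-comm-upTo (suc n) with ⊛-comm-upTo n
... | ih , ih′ = ih′ , step
  where
  step : ∀ f g → (f ⊛ g) (suc (suc n)) ≡ (g ⊛ f) (suc (suc n))
  step f g = begin
    a + (tail f ⊛ g) (suc n)                  ≡⟨ cong (λ x → a + x) (ih′ (tail f) g) ⟩
    a + (b + (tail g ⊛ tail f) n)              ≡⟨ cong (λ x → a + (b + x)) (ih (tail g) (tail f)) ⟩
    a + (b + (tail f ⊛ tail g) n)              ≡⟨ left-comm a b _ ⟩
    b + (a + (tail f ⊛ tail g) n)              ≡⟨ cong (λ x → b + x) (ih′ (tail g) f) ⟨
    b + (tail g ⊛ f) (suc n)                  ∎
    where
    open ≡-Reasoning
    a : ℤ
    a = f 0 * g (suc (suc n))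
    b : ℤ
    b = g 0 * f (suc (suc n))
    left-comm : ∀ a b c → a + (b + c) ≡ b + (a + c)
    left-comm = ℤ-solve-∀

⊛-comm : ∀ f g → f ⊛ g ≋ g ⊛ f
⊛-comm f g n = proj₁ (⊛-comm-upTo n) f g

⊛-assoc : ∀ f g h → (f ⊛ g) ⊛ h ≋ f ⊛ (g ⊛ h)
⊛-assoc f g h zero    = ℤP.*-assoc (f 0) (g 0) (h 0)
⊛-assoc f g h (suc n) = begin
  (f 0 * g 0) * h (suc n) + (tail (f ⊛ g) ⊛ h) n
    ≡⟨ cong (λ x → (f 0 * g 0) * h (suc n) + x) (⊛-distribʳ h (f 0 · tail g) (tail f ⊛ g) n) ⟩
  (f 0 * g 0) * h (suc n) + (((f 0 · tail g) ⊛ h) n + ((tail f ⊛ g) ⊛ h) n)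
    ≡⟨ cong₂ (λ x y → (f 0 * g 0) * h (suc n) + (x + y)) (⊛-·-assoc (f 0) (tail g) h n) (⊛-assoc (tail f) g h n) ⟩
  (f 0 * g 0) * h (suc n) + (f 0 * (tail g ⊛ h) n + (tail f ⊛ (g ⊛ h)) n)
    ≡⟨ regroup (f 0) (g 0) (h (suc n)) ((tail g ⊛ h) n) ((tail f ⊛ (g ⊛ h)) n) ⟩
  f 0 * (g 0 * h (suc n) + (tail g ⊛ h) n) + (tail f ⊛ (g ⊛ h)) n ∎
  where
  open ≡-Reasoning
  regroup : ∀ a b c d e → (a * b) * c + (a * d + e) ≡ a * (b * c + d) + e
  regroup = ℤ-solve-∀

⊛-zeroˡ : ∀ f → 𝟘 ⊛ f ≋ 𝟘
⊛-zeroˡ f zero    = refl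
⊛-zeroˡ f (suc n) = cong (λ x → + 0 * f (suc n) + x) (⊛-zeroˡ f n)

ι-⊛ : ∀ c f → ι c ⊛ f ≋ c · f
ι-⊛ c f zero    = refl
ι-⊛ c f (suc n) = trans (cong (λ x → c * f (suc n) + x) (⊛-zeroˡ f n)) (ℤP.+-identityʳ _)

⊛-identityˡ : ∀ f → 𝟙 ⊛ f ≋ f
⊛-identityˡ f n = trans (ι-⊛ (+ 1) f n) (ℤP.*-identityˡ (f n))

FPS-isCommutativeRing : IsCommutativeRing _≋_ _⊕_ _⊛_ ⊝_ 𝟘 𝟙
FPS-isCommutativeRing = record
  { isRing = record
    { +-isAbelianGroup = record
      { isGroup = record
        { isMonoid = record
          { isSemigroup = record
            { isMagma = record
              { isEquivalence = record { refl = ≋-refl ; sym = ≋-sym ; trans = ≋-trans }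
              ; ∙-cong = ⊕-cong }
            ; assoc = λ f g h n → ℤP.+-assoc (f n) (g n) (h n) }
          ; identity = (λ f n → ℤP.+-identityˡ (f n)) , (λ f n → ℤP.+-identityʳ (f n)) }
        ; inverse = (λ f n → ℤP.+-inverseˡ (f n)) , (λ f n → ℤP.+-inverseʳ (f n))
        ; ⁻¹-cong = ⊝-cong }
      ; comm = λ f g n → ℤP.+-comm (f n) (g n) }
    ; *-cong = ⊛-cong
    ; *-assoc = ⊛-assoc
    ; *-identity = ⊛-identityˡ , (λ f → ≋-trans (⊛-comm f 𝟙) (⊛-identityˡ f))
    ; distrib = (λ h f g → ≋-trans (⊛-comm h (f ⊕ g))
                            (≋-trans (⊛-distribʳ h f g) (⊕-cong (⊛-comm f h) (⊛-comm g h))))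
              , ⊛-distribʳ }
  ; *-comm = ⊛-comm }

FPS-commutativeRing : CommutativeRing 0ℓ 0ℓ
FPS-commutativeRing = record { isCommutativeRing = FPS-isCommutativeRing }

open CommutativeRing FPS-commutativeRing
  using () renaming (setoid to ≋-setoid; *-identityʳ to ⊛-identityʳ; zeroʳ to ⊛-zeroʳ)

open import Algebra.Properties.CommutativeSemigroup (CommutativeRing.*-commutativeSemigroup FPS-commutativeRing)
  using () renaming (interchange to ⊛-interchange)

ι-· : ∀ a b → a · ι b ≋ ι (a * b)
ι-· a b zero    = refl
ι-· a b (suc n) = ℤP.*-zeroʳ a

ι-≟ : ∀ a b → Maybe (ι a ≋ ι b)
ι-≟ a b with a ℤP.≟ b
... | yes refl = just ≋-refl
... | no _     = nothing

ι-homomorphism : ℤ.+-*-rawRing -Raw-AlmostCommutative⟶ fromCommutativeRing FPS-commutativeRing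
ι-homomorphism = record
  { ⟦_⟧    = ι
  ; +-homo = λ { a b zero → refl ; a b (suc n) → refl }
  ; *-homo = λ a b → ≋-sym (≋-trans (ι-⊛ a (ι b)) (ι-· a b))
  ; -‿homo = λ { a zero → refl ; a (suc n) → refl }
  ; 0-homo = λ { zero → refl ; (suc n) → refl }
  ; 1-homo = ≋-refl }

module FPS-Solver = Algebra.Solver.Ring ℤ.+-*-rawRing (fromCommutativeRing FPS-commutativeRing)
  ι-homomorphism ι-≟
open FPS-Solver using (solve; _:=_; _:+_; _:*_; :-_; _:-_; con)

Σ< : ℕ → (ℕ → ℤ) → ℤ
Σ< n h = sum (applyUpTo h n)

Σ<-cong : ∀ n {g h} → (∀ k → k < n → g k ≡ h k) → Σ< n g ≡ Σ< n h
Σ<-cong zero    g≡h = refl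
Σ<-cong (suc n) g≡h = cong₂ _+_ (g≡h 0 (s≤s z≤n)) (Σ<-cong n (λ k k<n → g≡h (suc k) (s≤s k<n)))

Σ<-snoc : ∀ n h → Σ< (suc n) h ≡ Σ< n h + h n
Σ<-snoc zero    h = trans (ℤP.+-identityʳ (h 0)) (sym (ℤP.+-identityˡ (h 0)))
Σ<-snoc (suc n) h = trans (cong (λ x → h 0 + x) (Σ<-snoc n (h ∘ suc))) (sym (ℤP.+-assoc (h 0) (Σ< n (h ∘ suc)) (h (suc n))))

Σ<-+ : ∀ n (g h : ℕ → ℤ) → Σ< n g + Σ< n h ≡ Σ< n (λ k → g k + h k)
Σ<-+ zero    g h = refl
Σ<-+ (suc n) g h = trans (+-interchange (g 0) (Σ< n (g ∘ suc)) (h 0) (Σ< n (h ∘ suc)))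
                         (cong (λ x → (g 0 + h 0) + x) (Σ<-+ n (g ∘ suc) (h ∘ suc)))

Σ<-neg : ∀ n (h : ℕ → ℤ) → Σ< n (λ k → - h k) ≡ - Σ< n h
Σ<-neg zero    h = refl
Σ<-neg (suc n) h = trans (cong (λ x → - h 0 + x) (Σ<-neg n (h ∘ suc))) (sym (ℤP.neg-distrib-+ (h 0) (Σ< n (h ∘ suc))))

Σ<-telescope : ∀ n (h : ℕ → ℤ) → Σ< n (λ k → h (suc k) + - h k) ≡ h n + - h 0
Σ<-telescope zero    h = sym (ℤP.+-inverseʳ (h 0))
Σ<-telescope (suc n) h = trans (cong (λ x → (h 1 + - h 0) + x) (Σ<-telescope n (h ∘ suc)))
                               (collapse (h 0) (h 1) (h (suc n)))
  where
  collapse : ∀ a b c → (b + - a) + (c + - b) ≡ c + - a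
  collapse = ℤ-solve-∀

Σ<-vanishing : ∀ n (h : ℕ → ℤ) → (∀ k → h k ≡ + 0) → Σ< n h ≡ + 0
Σ<-vanishing zero    h h≡0 = refl
Σ<-vanishing (suc n) h h≡0 = cong₂ _+_ (h≡0 0) (Σ<-vanishing n (h ∘ suc) (h≡0 ∘ suc))

Σ<-extend : ∀ n m (h : ℕ → ℤ) → n ≤ m → (∀ k → n ≤ k → h k ≡ + 0) → Σ< m h ≡ Σ< n h
Σ<-extend zero    m       h _         h≡0 = Σ<-vanishing m h (λ k → h≡0 k z≤n)
Σ<-extend (suc n) (suc m) h (s≤s n≤m) h≡0 =
  cong (λ x → h 0 + x) (Σ<-extend n m (h ∘ suc) n≤m (λ k n≤k → h≡0 (suc k) (s≤s n≤k)))

Σ<-stable : ∀ n m (h : ℕ → ℤ) → (∀ k → n ≤ k → h k ≡ + 0) → (∀ k → m ≤ k → h k ≡ + 0) → Σ< n h ≡ Σ< m h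
Σ<-stable n m h h≡0₁ h≡0₂ with ℕP.≤-total n m
... | inj₁ n≤m = sym (Σ<-extend n m h n≤m h≡0₁)
... | inj₂ m≤n = Σ<-extend m n h m≤n h≡0₂

one≋𝟙 : one ≋ 𝟙
one≋𝟙 zero    = refl
one≋𝟙 (suc n) = refl

⊛-as-sum : ∀ N f g → (f ⊛ g) N ≡ Σ< (suc N) (λ k → f k * g (N ℕ.∸ k))
⊛-as-sum zero    f g = sym (ℤP.+-identityʳ (f 0 * g 0))
⊛-as-sum (suc N) f g = cong (λ x → f 0 * g (suc N) + x) (⊛-as-sum N (tail f) g)

mul≋⊛ : ∀ f g → mul f g ≋ f ⊛ g
mul≋⊛ f g N = trans (cong sum (map-upTo (λ k → f k * g (N ℕ.∸ k)) (suc N))) (sym (⊛-as-sum N f g))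

dotRev-invRev : ∀ f N i h → (∀ k → h k ≡ f (suc (i ℕ.+ k))) →
                dotRev f i (invRev f N) ≡ (h ⊛ inv f) N
dotRev-invRev f zero i h h≡ =
  trans (ℤP.+-identityʳ _) (cong (_* + 1) (sym (trans (h≡ 0) (cong (f ∘ suc) (ℕP.+-identityʳ i)))))
dotRev-invRev f (suc N) i h h≡ = cong₂ _+_
  (cong (_* inv f (suc N)) (sym (trans (h≡ 0) (cong (f ∘ suc) (ℕP.+-identityʳ i)))))
  (dotRev-invRev f N (suc i) (tail h) (λ k → trans (h≡ (suc k)) (cong (f ∘ suc) (ℕP.+-suc i k))))

inv-inverseʳ : ∀ f → f 0 ≡ + 1 → f ⊛ inv f ≋ 𝟙
inv-inverseʳ f f0≡1 zero    = cong (_* + 1) f0≡1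
inv-inverseʳ f f0≡1 (suc N) = begin
  f 0 * - dotRev f 0 (invRev f N) + (tail f ⊛ inv f) N
    ≡⟨ cong₂ (λ a b → a * - b + (tail f ⊛ inv f) N) f0≡1 (dotRev-invRev f N 0 (tail f) (λ _ → refl)) ⟩
  + 1 * - (tail f ⊛ inv f) N + (tail f ⊛ inv f) N
    ≡⟨ cong (_+ (tail f ⊛ inv f) N) (ℤP.*-identityˡ (- (tail f ⊛ inv f) N)) ⟩
  - (tail f ⊛ inv f) N + (tail f ⊛ inv f) N
    ≡⟨ ℤP.+-inverseˡ ((tail f ⊛ inv f) N) ⟩
  + 0 ∎
  where open ≡-Reasoning

q^_ : ℕ → FPS
(q^ k) n = if n ≡ᵇ k then + 1 else + 0

shift : FPS → FPS
shift f zero    = + 0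
shift f (suc n) = f n

shift-⊛ : ∀ f g → shift f ⊛ g ≋ shift (f ⊛ g)
shift-⊛ f g zero    = ℤP.*-zeroˡ (g 0)
shift-⊛ f g (suc n) = trans (cong (_+ (f ⊛ g) n) (ℤP.*-zeroˡ (g (suc n)))) (ℤP.+-identityˡ _)

q^0≋𝟙 : q^ 0 ≋ 𝟙
q^0≋𝟙 zero    = refl
q^0≋𝟙 (suc n) = refl

q^suc-⊛ : ∀ e f → q^ suc e ⊛ f ≋ shift (q^ e ⊛ f)
q^suc-⊛ e f = ≋-trans (⊛-cong q^suc≋shift ≋-refl) (shift-⊛ (q^ e) f)
  where
  q^suc≋shift : q^ suc e ≋ shift (q^ e)
  q^suc≋shift zero    = refl
  q^suc≋shift (suc n) = refl

q^-+ : ∀ a b → q^ (a ℕ.+ b) ≋ q^ a ⊛ q^ b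
q^-+ zero    b = ≋-trans (≋-sym (⊛-identityˡ (q^ b))) (⊛-cong (≋-sym q^0≋𝟙) ≋-refl)
q^-+ (suc a) b = ≋-trans (λ { zero → refl ; (suc n) → q^-+ a b n }) (≋-sym (q^suc-⊛ a (q^ b)))

q^-< : ∀ e n → n < e → (q^ e) n ≡ + 0
q^-< (suc e) zero    _         = refl
q^-< (suc e) (suc n) (s≤s n<e) = q^-< e n n<e

infix 4 _≈[_]_
_≈[_]_ : FPS → ℕ → FPS → Set
f ≈[ K ] g = ∀ n → n < K → f n ≡ g n

≈-refl : ∀ {K f} → f ≈[ K ] f
≈-refl n _ = refl

≈-sym : ∀ {K f g} → f ≈[ K ] g → g ≈[ K ] f
≈-sym p n n<K = sym (p n n<K)

≈-trans : ∀ {K f g h} → f ≈[ K ] g → g ≈[ K ] h → f ≈[ K ] h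
≈-trans p q n n<K = trans (p n n<K) (q n n<K)

≋⇒≈ : ∀ {K f g} → f ≋ g → f ≈[ K ] g
≋⇒≈ p n _ = p n

≈-weaken : ∀ {K K′ f g} → K′ ≤ K → f ≈[ K ] g → f ≈[ K′ ] g
≈-weaken K′≤K p n n<K′ = p n (ℕP.<-≤-trans n<K′ K′≤K)

≈[_]-setoid : ℕ → Setoid 0ℓ 0ℓ
≈[ K ]-setoid = record
  { Carrier = FPS ; _≈_ = _≈[ K ]_
  ; isEquivalence = record { refl = ≈-refl ; sym = ≈-sym ; trans = ≈-trans } }

⊕-cong-≈ : ∀ {K f f′ g g′} → f ≈[ K ] f′ → g ≈[ K ] g′ → f ⊕ g ≈[ K ] f′ ⊕ g′
⊕-cong-≈ p q n n<K = cong₂ _+_ (p n n<K) (q n n<K)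

⊝-cong-≈ : ∀ {K f f′} → f ≈[ K ] f′ → ⊝ f ≈[ K ] ⊝ f′
⊝-cong-≈ p n n<K = cong -_ (p n n<K)

⊛-coeff-cong : ∀ n f f′ g g′ → (∀ m → m ≤ n → f m ≡ f′ m) → (∀ m → m ≤ n → g m ≡ g′ m) →
               (f ⊛ g) n ≡ (f′ ⊛ g′) n
⊛-coeff-cong zero    f f′ g g′ p q = cong₂ _*_ (p 0 z≤n) (q 0 z≤n)
⊛-coeff-cong (suc n) f f′ g g′ p q = cong₂ _+_ (cong₂ _*_ (p 0 z≤n) (q (suc n) ℕP.≤-refl))
  (⊛-coeff-cong n (tail f) (tail f′) g g′ (λ m m≤n → p (suc m) (s≤s m≤n)) (λ m m≤n → q m (ℕP.m≤n⇒m≤1+n m≤n)))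

⊛-cong-≈ : ∀ {K f f′ g g′} → f ≈[ K ] f′ → g ≈[ K ] g′ → f ⊛ g ≈[ K ] f′ ⊛ g′
⊛-cong-≈ {f = f} {f′} {g} {g′} p q n n<K = ⊛-coeff-cong n f f′ g g′
  (λ m m≤n → p m (ℕP.≤-<-trans m≤n n<K)) (λ m m≤n → q m (ℕP.≤-<-trans m≤n n<K))

q^-⊛-cong-≈ : ∀ e {K f g} → f ≈[ K ] g → q^ e ⊛ f ≈[ e ℕ.+ K ] q^ e ⊛ g
q^-⊛-cong-≈ zero    {f = f} {g} p = ≈-trans (≋⇒≈ (⊛-identityˡ′ f)) (≈-trans p (≋⇒≈ (≋-sym (⊛-identityˡ′ g))))
  where
  ⊛-identityˡ′ : ∀ h → q^ 0 ⊛ h ≋ h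
  ⊛-identityˡ′ h = ≋-trans (⊛-cong q^0≋𝟙 ≋-refl) (⊛-identityˡ h)
q^-⊛-cong-≈ (suc e) {f = f} {g} p zero    _             =
  trans (q^suc-⊛ e f 0) (sym (q^suc-⊛ e g 0))
q^-⊛-cong-≈ (suc e) {f = f} {g} p (suc n) (s≤s n<e+K) =
  trans (q^suc-⊛ e f (suc n)) (trans (q^-⊛-cong-≈ e p n n<e+K) (sym (q^suc-⊛ e g (suc n))))

⊛-cancelʳ-≈ : ∀ {K} f g h → h 0 ≡ + 1 → f ⊛ h ≈[ K ] g ⊛ h → f ≈[ K ] g
⊛-cancelʳ-≈ {K} f g h h0≡1 fh≈gh = begin
  f                 ≈⟨ ≋⇒≈ (unit f) ⟨
  (f ⊛ h) ⊛ inv h   ≈⟨ ⊛-cong-≈ fh≈gh ≈-refl ⟩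
  (g ⊛ h) ⊛ inv h   ≈⟨ ≋⇒≈ (unit g) ⟩
  g                 ∎
  where
  open import Relation.Binary.Reasoning.Setoid ≈[ K ]-setoid
  unit : ∀ u → (u ⊛ h) ⊛ inv h ≋ u
  unit u = ≋-trans (⊛-assoc u h (inv h)) (≋-trans (⊛-cong ≋-refl (inv-inverseʳ h h0≡1)) (⊛-identityʳ u))

∏ : ℕ → (ℕ → FPS) → FPS
∏ zero    f = 𝟙
∏ (suc n) f = ∏ n f ⊛ f n

syntax ∏ n (λ k → e) = ∏[ k < n ] e

∏-head : ∀ n f → (∀ k → f k 0 ≡ + 1) → ∏ n f 0 ≡ + 1
∏-head zero    f f0≡1 = refl
∏-head (suc n) f f0≡1 = cong₂ _*_ (∏-head n f f0≡1) (f0≡1 n)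

∏-stable : ∀ {K} f n m → n ≤ m → (∀ k → n ≤ k → f k ≈[ K ] 𝟙) → ∏ m f ≈[ K ] ∏ n f
∏-stable {K} f n m n≤m f≈𝟙 with ℕP.m≤n⇒∃[o]m+o≡n n≤m
... | d , refl = extend d
  where
  open import Relation.Binary.Reasoning.Setoid ≈[ K ]-setoid
  extend : ∀ d → ∏ (n ℕ.+ d) f ≈[ K ] ∏ n f
  extend zero    = ≋⇒≈ (≋-reflexive (cong (λ m → ∏ m f) (ℕP.+-identityʳ n)))
  extend (suc d) = begin
    ∏ (n ℕ.+ suc d) f              ≡⟨ cong (λ m → ∏ m f) (ℕP.+-suc n d) ⟩
    ∏ (n ℕ.+ d) f ⊛ f (n ℕ.+ d)    ≈⟨ ⊛-cong-≈ (extend d) (f≈𝟙 (n ℕ.+ d) (ℕP.m≤m+n n d)) ⟩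
    ∏ n f ⊛ 𝟙                      ≈⟨ ≋⇒≈ (⊛-identityʳ (∏ n f)) ⟩
    ∏ n f                          ∎

1-_ 1+_ : FPS → FPS
1- x = 𝟙 ⊕ ⊝ x
1+ x = 𝟙 ⊕ x

1--cong : ∀ {x y} → x ≋ y → 1- x ≋ 1- y
1--cong x≋y = ⊕-congˡ 𝟙 (⊝-cong x≋y)

q^-≈𝟘 : ∀ {K} e → K ≤ e → q^ e ≈[ K ] 𝟘
q^-≈𝟘 e K≤e n n<K = q^-< e n (ℕP.<-≤-trans n<K K≤e)

1+-≈𝟙 : ∀ {K x} → x ≈[ K ] 𝟘 → 1+ x ≈[ K ] 𝟙
1+-≈𝟙 x≈0 n n<K = trans (cong (λ c → 𝟙 n + c) (x≈0 n n<K)) (ℤP.+-identityʳ (𝟙 n))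

1--≈𝟙 : ∀ {K x} → x ≈[ K ] 𝟘 → 1- x ≈[ K ] 𝟙
1--≈𝟙 x≈0 = 1+-≈𝟙 (⊝-cong-≈ x≈0)

poch-q poch-−q poch-odd poch-even : ℕ → FPS
poch-q    n = ∏[ k < n ] 1- q^ suc k
poch-−q   n = ∏[ k < n ] 1+ q^ suc k
poch-odd  n = ∏[ k < n ] 1- q^ suc (2 ℕ.* k)
poch-even n = ∏[ k < n ] 1- q^ (2 ℕ.* suc k)

poch-−q⊛poch-q : ∀ n → poch-−q n ⊛ poch-q n ≋ poch-even n
poch-−q⊛poch-q zero    = ⊛-identityˡ 𝟙
poch-−q⊛poch-q (suc n) = begin
  (poch-−q n ⊛ 1+ x) ⊛ (poch-q n ⊛ 1- x)   ≈⟨ ⊛-interchange (poch-−q n) (1+ x) (poch-q n) (1- x) ⟩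
  (poch-−q n ⊛ poch-q n) ⊛ (1+ x ⊛ 1- x)   ≈⟨ ⊛-cong (poch-−q⊛poch-q n) (difference-of-squares x) ⟩
  poch-even n ⊛ 1- (x ⊛ x)                 ≈⟨ ⊛-congˡ (poch-even n) (1--cong (≋-sym (q^-+ (suc n) (suc n)))) ⟩
  poch-even n ⊛ 1- q^ (suc n ℕ.+ suc n)    ≡⟨ cong (λ e → poch-even n ⊛ 1- q^ e) (cong (suc n ℕ.+_) (ℕP.+-identityʳ (suc n))) ⟨
  poch-even (suc n)                        ∎
  where
  open import Relation.Binary.Reasoning.Setoid ≋-setoid
  x : FPS
  x = q^ suc n
  difference-of-squares : ∀ x → 1+ x ⊛ 1- x ≋ 1- (x ⊛ x)
  difference-of-squares = solve 1 (λ x → (con (+ 1) :+ x) :* (con (+ 1) :- x) := con (+ 1) :- x :* x) ≋-refl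

poch-q-double : ∀ n → poch-q (2 ℕ.* n) ≋ poch-odd n ⊛ poch-even n
poch-q-double zero    = ≋-sym (⊛-identityˡ 𝟙)
poch-q-double (suc n) = begin
  poch-q (2 ℕ.* suc n)                                       ≡⟨ cong poch-q (ℕP.*-suc 2 n) ⟩
  (poch-q (2 ℕ.* n) ⊛ 1- q^ suc (2 ℕ.* n)) ⊛ 1- q^ suc (suc (2 ℕ.* n))
    ≈⟨ ⊛-assoc (poch-q (2 ℕ.* n)) _ _ ⟩
  poch-q (2 ℕ.* n) ⊛ (1- q^ suc (2 ℕ.* n) ⊛ 1- q^ suc (suc (2 ℕ.* n)))
    ≈⟨ ⊛-congʳ _ (poch-q-double n) ⟩
  (poch-odd n ⊛ poch-even n) ⊛ (1- q^ suc (2 ℕ.* n) ⊛ 1- q^ suc (suc (2 ℕ.* n)))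
    ≈⟨ ⊛-interchange (poch-odd n) (1- q^ suc (2 ℕ.* n)) (poch-even n) _ ⟨
  poch-odd (suc n) ⊛ (poch-even n ⊛ 1- q^ suc (suc (2 ℕ.* n)))
    ≡⟨ cong (λ e → poch-odd (suc n) ⊛ (poch-even n ⊛ 1- q^ e)) (ℕP.*-suc 2 n) ⟨
  poch-odd (suc n) ⊛ poch-even (suc n)                       ∎
  where open import Relation.Binary.Reasoning.Setoid ≋-setoid

factor-+1 : ∀ k → factor (+ 1) k ≋ 1- q^ suc k
factor-+1 k zero    = refl
factor-+1 k (suc n) with n ≡ᵇ k
... | true  = refl
... | false = refl

factor--1 : ∀ k → factor (- + 1) k ≋ 1+ q^ suc k
factor--1 k zero    = refl
factor--1 k (suc n) with n ≡ᵇ k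
... | true  = refl
... | false = refl

prodFin≋∏ : ∀ c F → (∀ k → factor c k ≋ F k) → ∀ K → prodFin c K ≋ ∏ K F
prodFin≋∏ c F fac zero    = one≋𝟙
prodFin≋∏ c F fac (suc K) = ≋-trans (mul≋⊛ (prodFin c K) (factor c K)) (⊛-cong (prodFin≋∏ c F fac K) (fac K))

poch-coeff : ∀ c F → (∀ k → factor c k ≋ F k) → (∀ k → F k ≈[ suc k ] 𝟙) →
             ∀ m E → E < m → poch c E ≡ ∏ m F E
poch-coeff c F fac F≈𝟙 m E E<m = trans (prodFin≋∏ c F fac (suc E) E)
  (sym (∏-stable F (suc E) m E<m (λ k E<k → ≈-weaken (ℕP.m≤n⇒m≤1+n E<k) (F≈𝟙 k)) E ℕP.≤-refl))

qPoch-coeff : ∀ m E → E < m → qPoch E ≡ poch-q m E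
qPoch-coeff = poch-coeff (+ 1) (λ k → 1- q^ suc k) factor-+1 (λ k → 1--≈𝟙 (q^-≈𝟘 (suc k) ℕP.≤-refl))

mqPoch-coeff : ∀ m E → E < m → mqPoch E ≡ poch-−q m E
mqPoch-coeff = poch-coeff (- + 1) (λ k → 1+ q^ suc k) factor--1 (λ k → 1+-≈𝟙 (q^-≈𝟘 (suc k) ℕP.≤-refl))

p^_ : ℕ → FPS
p^ k = q^ (2 ℕ.* k)

p^-+ : ∀ a b → p^ a ⊛ p^ b ≋ p^ (a ℕ.+ b)
p^-+ a b = ≋-trans (≋-sym (q^-+ (2 ℕ.* a) (2 ℕ.* b))) (≋-reflexive (cong q^_ (sym (ℕP.*-distribˡ-+ 2 a b))))

p^∸⊛p^suc : ∀ m j → j ≤ m → p^ (m ℕ.∸ j) ⊛ p^ suc j ≋ p^ suc m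
p^∸⊛p^suc m j j≤m = ≋-trans (p^-+ (m ℕ.∸ j) (suc j))
  (≋-reflexive (cong p^_ (trans (ℕP.+-suc (m ℕ.∸ j) j) (cong suc (ℕP.m∸n+n≡m j≤m)))))

1-p^0≋𝟘 : 1- p^ 0 ≋ 𝟘
1-p^0≋𝟘 zero    = refl
1-p^0≋𝟘 (suc n) = refl

qbinom : ℕ → ℕ → FPS
qbinom m       zero    = 𝟙
qbinom zero    (suc j) = 𝟘
qbinom (suc m) (suc j) = qbinom m (suc j) ⊕ p^ (m ℕ.∸ j) ⊛ qbinom m j

qbinom-> : ∀ m j → m < j → qbinom m j ≋ 𝟘
qbinom-> zero    (suc j) _         = ≋-refl
qbinom-> (suc m) (suc j) (s≤s m<j) n =
  trans (cong₂ _+_ (qbinom-> m (suc j) (ℕP.m<n⇒m<1+n m<j) n)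
                   (trans (⊛-congˡ (p^ (m ℕ.∸ j)) (qbinom-> m j m<j) n) (⊛-zeroʳ (p^ (m ℕ.∸ j)) n)))
        refl

both-zero : ∀ a b {X Y} → X ≋ 𝟘 → Y ≋ 𝟘 → a ⊛ X ≋ b ⊛ Y
both-zero a b X≋𝟘 Y≋𝟘 = ≋-trans (⊛-congˡ a X≋𝟘) (≋-trans (⊛-zeroʳ a) (≋-sym (≋-trans (⊛-congˡ b Y≋𝟘) (⊛-zeroʳ b))))

distribˡ-shifted : ∀ c a X Y → (1- c) ⊛ (X ⊕ a ⊛ Y) ≋ (1- c) ⊛ X ⊕ a ⊛ ((1- c) ⊛ Y)
distribˡ-shifted = solve 4 (λ c a X Y → (con (+ 1) :- c) :* (X :+ a :* Y) :=
                                      (con (+ 1) :- c) :* X :+ a :* ((con (+ 1) :- c) :* Y)) ≋-refl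

telescope : ∀ a b Y → (1- a) ⊛ Y ⊕ a ⊛ ((1- b) ⊛ Y) ≋ (1- (a ⊛ b)) ⊛ Y
telescope = solve 3 (λ a b Y → (con (+ 1) :- a) :* Y :+ a :* ((con (+ 1) :- b) :* Y) :=
                               (con (+ 1) :- a :* b) :* Y) ≋-refl

qbinom-ratio : ∀ m j → (1- p^ suc j) ⊛ qbinom m (suc j) ≋ (1- p^ (m ℕ.∸ j)) ⊛ qbinom m j
qbinom-absorb-suc : ∀ m j → (1- p^ suc j) ⊛ qbinom (suc m) (suc j) ≋ (1- p^ suc m) ⊛ qbinom m j
qbinom-absorb : ∀ m j → (1- p^ (suc m ℕ.∸ j)) ⊛ qbinom (suc m) j ≋ (1- p^ suc m) ⊛ qbinom m j

qbinom-ratio zero    zero    = ≋-trans (⊛-zeroʳ (1- p^ 1)) (≋-sym (≋-trans (⊛-congʳ 𝟙 1-p^0≋𝟘) (⊛-zeroˡ 𝟙)))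
qbinom-ratio zero    (suc j) = both-zero (1- p^ suc (suc j)) (1- p^ 0) ≋-refl ≋-refl
qbinom-ratio (suc m) j       = ≋-trans (qbinom-absorb-suc m j) (≋-sym (qbinom-absorb m j))

qbinom-absorb-suc m j with j ℕP.≤? m
... | no j≰m = both-zero (1- p^ suc j) (1- p^ suc m)
                 (qbinom-> (suc m) (suc j) (s≤s (ℕP.≰⇒> j≰m))) (qbinom-> m j (ℕP.≰⇒> j≰m))
... | yes j≤m = begin
  (1- p^ suc j) ⊛ (qbinom m (suc j) ⊕ a ⊛ qbinom m j)
    ≈⟨ distribˡ-shifted (p^ suc j) a (qbinom m (suc j)) (qbinom m j) ⟩
  (1- p^ suc j) ⊛ qbinom m (suc j) ⊕ a ⊛ ((1- p^ suc j) ⊛ qbinom m j)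
    ≈⟨ ⊕-congʳ (a ⊛ ((1- p^ suc j) ⊛ qbinom m j)) (qbinom-ratio m j) ⟩
  (1- a) ⊛ qbinom m j ⊕ a ⊛ ((1- p^ suc j) ⊛ qbinom m j)
    ≈⟨ telescope a (p^ suc j) (qbinom m j) ⟩
  (1- (a ⊛ p^ suc j)) ⊛ qbinom m j
    ≈⟨ ⊛-congʳ (qbinom m j) (1--cong (p^∸⊛p^suc m j j≤m)) ⟩
  (1- p^ suc m) ⊛ qbinom m j ∎
  where
  open import Relation.Binary.Reasoning.Setoid ≋-setoid
  a : FPS
  a = p^ (m ℕ.∸ j)

qbinom-absorb m zero    = ≋-refl
qbinom-absorb m (suc j) with j ℕP.≤? m
... | no j≰m = both-zero (1- p^ (m ℕ.∸ j)) (1- p^ suc m)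
                 (qbinom-> (suc m) (suc j) (s≤s (ℕP.≰⇒> j≰m))) (qbinom-> m (suc j) (ℕP.m<n⇒m<1+n (ℕP.≰⇒> j≰m)))
... | yes j≤m = begin
  (1- a) ⊛ (qbinom m (suc j) ⊕ a ⊛ qbinom m j)
    ≈⟨ distribˡ-shifted a a (qbinom m (suc j)) (qbinom m j) ⟩
  (1- a) ⊛ qbinom m (suc j) ⊕ a ⊛ ((1- a) ⊛ qbinom m j)
    ≈⟨ ⊕-congˡ ((1- a) ⊛ qbinom m (suc j)) (⊛-congˡ a (qbinom-ratio m j)) ⟨
  (1- a) ⊛ qbinom m (suc j) ⊕ a ⊛ ((1- p^ suc j) ⊛ qbinom m (suc j))
    ≈⟨ telescope a (p^ suc j) (qbinom m (suc j)) ⟩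
  (1- (a ⊛ p^ suc j)) ⊛ qbinom m (suc j)
    ≈⟨ ⊛-congʳ (qbinom m (suc j)) (1--cong (p^∸⊛p^suc m j j≤m)) ⟩
  (1- p^ suc m) ⊛ qbinom m (suc j) ∎
  where
  open import Relation.Binary.Reasoning.Setoid ≋-setoid
  a : FPS
  a = p^ (m ℕ.∸ j)

qbinom-pascal′ : ∀ m j → qbinom (suc m) (suc j) ≋ qbinom m j ⊕ p^ suc j ⊛ qbinom m (suc j)
qbinom-pascal′ m j = begin
  X ⊕ a ⊛ Y                                          ≈⟨ rearrange X Y a b ⟩
  (Y ⊕ b ⊛ X) ⊕ ((1- b) ⊛ X ⊕ ⊝ ((1- a) ⊛ Y))        ≈⟨ ⊕-congˡ (Y ⊕ b ⊛ X) cancel ⟩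
  (Y ⊕ b ⊛ X) ⊕ 𝟘                                    ≈⟨ (λ n → ℤP.+-identityʳ ((Y ⊕ b ⊛ X) n)) ⟩
  Y ⊕ b ⊛ X                                          ∎
  where
  open import Relation.Binary.Reasoning.Setoid ≋-setoid
  X : FPS
  X = qbinom m (suc j)
  Y : FPS
  Y = qbinom m j
  a : FPS
  a = p^ (m ℕ.∸ j)
  b : FPS
  b = p^ suc j
  rearrange : ∀ X Y a b → X ⊕ a ⊛ Y ≋ (Y ⊕ b ⊛ X) ⊕ ((1- b) ⊛ X ⊕ ⊝ ((1- a) ⊛ Y))
  rearrange = solve 4 (λ X Y a b → X :+ a :* Y :=
    (Y :+ b :* X) :+ ((con (+ 1) :- b) :* X :- (con (+ 1) :- a) :* Y)) ≋-refl
  cancel : (1- b) ⊛ X ⊕ ⊝ ((1- a) ⊛ Y) ≋ 𝟘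
  cancel n = trans (cong (_+ - ((1- a) ⊛ Y) n) (qbinom-ratio m j n)) (ℤP.+-inverseʳ (((1- a) ⊛ Y) n))

qbinom-poch : ∀ m j → j ≤ m → (qbinom m j ⊛ poch-even j) ⊛ poch-even (m ℕ.∸ j) ≋ poch-even m
qbinom-poch m       zero    _         = ≋-trans (⊛-congʳ (poch-even m) (⊛-identityˡ 𝟙)) (⊛-identityˡ (poch-even m))
qbinom-poch (suc m) (suc j) (s≤s j≤m) = begin
  ((X ⊕ a ⊛ Y) ⊛ (P j ⊛ c)) ⊛ P (m ℕ.∸ j)
    ≈⟨ expand X Y a (P j) c (P (m ℕ.∸ j)) ⟩
  (X ⊛ (P j ⊛ c)) ⊛ P (m ℕ.∸ j) ⊕ (a ⊛ c) ⊛ ((Y ⊛ P j) ⊛ P (m ℕ.∸ j))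
    ≈⟨ ⊕-cong first-term (⊛-congˡ (a ⊛ c) (qbinom-poch m j j≤m)) ⟩
  P m ⊛ (1- a) ⊕ (a ⊛ c) ⊛ P m
    ≈⟨ collect (P m) a (p^ suc j) ⟩
  P m ⊛ (1- (a ⊛ p^ suc j))
    ≈⟨ ⊛-congˡ (P m) (1--cong (p^∸⊛p^suc m j j≤m)) ⟩
  P (suc m) ∎
  where
  open import Relation.Binary.Reasoning.Setoid ≋-setoid
  P : ℕ → FPS
  P = poch-even
  X : FPS
  X = qbinom m (suc j)
  Y : FPS
  Y = qbinom m j
  a : FPS
  a = p^ (m ℕ.∸ j)
  c : FPS
  c = 1- p^ suc j
  expand : ∀ X Y a Pj c Pk → ((X ⊕ a ⊛ Y) ⊛ (Pj ⊛ c)) ⊛ Pk ≋ (X ⊛ (Pj ⊛ c)) ⊛ Pk ⊕ (a ⊛ c) ⊛ ((Y ⊛ Pj) ⊛ Pk)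
  expand = solve 6 (λ X Y a Pj c Pk → ((X :+ a :* Y) :* (Pj :* c)) :* Pk :=
                                      (X :* (Pj :* c)) :* Pk :+ (a :* c) :* ((Y :* Pj) :* Pk)) ≋-refl
  collect : ∀ Pm a b → Pm ⊛ (1- a) ⊕ (a ⊛ (1- b)) ⊛ Pm ≋ Pm ⊛ (1- (a ⊛ b))
  collect = solve 3 (λ Pm a b → Pm :* (con (+ 1) :- a) :+ (a :* (con (+ 1) :- b)) :* Pm :=
                                Pm :* (con (+ 1) :- a :* b)) ≋-refl
  first-term : (X ⊛ (P j ⊛ c)) ⊛ P (m ℕ.∸ j) ≋ P m ⊛ (1- a)
  first-term with ℕP.m≤n⇒m<n∨m≡n j≤m
  ... | inj₂ refl = begin
    (X ⊛ P (suc j)) ⊛ P (j ℕ.∸ j)   ≈⟨ ⊛-congʳ (P (j ℕ.∸ j)) (⊛-congʳ (P (suc j)) (qbinom-> j (suc j) ℕP.≤-refl)) ⟩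
    (𝟘 ⊛ P (suc j)) ⊛ P (j ℕ.∸ j)   ≈⟨ ⊛-congʳ (P (j ℕ.∸ j)) (⊛-zeroˡ (P (suc j))) ⟩
    𝟘 ⊛ P (j ℕ.∸ j)                 ≈⟨ ⊛-zeroˡ (P (j ℕ.∸ j)) ⟩
    𝟘                               ≈⟨ ⊛-zeroʳ (P j) ⟨
    P j ⊛ 𝟘                         ≈⟨ ⊛-congˡ (P j) (≋-trans (1--cong (≋-reflexive (cong p^_ (ℕP.n∸n≡0 j)))) 1-p^0≋𝟘) ⟨
    P j ⊛ (1- a)                    ∎
  ... | inj₁ j<m = begin
    (X ⊛ P (suc j)) ⊛ P (m ℕ.∸ j)                              ≡⟨ cong (λ k → (X ⊛ P (suc j)) ⊛ P k) m∸j≡ ⟩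
    (X ⊛ P (suc j)) ⊛ (P (m ℕ.∸ suc j) ⊛ 1- p^ suc (m ℕ.∸ suc j)) ≈⟨ ⊛-assoc (X ⊛ P (suc j)) _ _ ⟨
    ((X ⊛ P (suc j)) ⊛ P (m ℕ.∸ suc j)) ⊛ 1- p^ suc (m ℕ.∸ suc j) ≈⟨ ⊛-congʳ _ (qbinom-poch m (suc j) j<m) ⟩
    P m ⊛ 1- p^ suc (m ℕ.∸ suc j)                              ≡⟨ cong (λ k → P m ⊛ 1- p^ k) m∸j≡ ⟨
    P m ⊛ (1- a)                                               ∎
    where
    m∸j≡ : m ℕ.∸ j ≡ suc (m ℕ.∸ suc j)
    m∸j≡ = ℕP.+-∸-assoc 1 j<m

poch-even-grow : ∀ {K} a b → a ≤ b → K ≤ 2 ℕ.* suc a → poch-even b ≈[ K ] poch-even a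
poch-even-grow a b a≤b K≤a = ∏-stable (λ k → 1- q^ (2 ℕ.* suc k)) a b a≤b
  (λ k a≤k → 1--≈𝟙 (q^-≈𝟘 (2 ℕ.* suc k) (ℕP.≤-trans K≤a (ℕP.*-monoʳ-≤ 2 (s≤s a≤k)))))

poch-even-stable : ∀ {K} a b → K ≤ 2 ℕ.* suc a → K ≤ 2 ℕ.* suc b → poch-even a ≈[ K ] poch-even b
poch-even-stable a b K≤a K≤b with ℕP.≤-total a b
... | inj₁ a≤b = ≈-sym (poch-even-grow a b a≤b K≤a)
... | inj₂ b≤a = poch-even-grow b a b≤a K≤b

qbinom⊛poch-even-≈𝟙 : ∀ {K} m j → j ≤ m → K ≤ 2 ℕ.* suc j → K ≤ 2 ℕ.* suc (m ℕ.∸ j) →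
                      qbinom m j ⊛ poch-even m ≈[ K ] 𝟙
qbinom⊛poch-even-≈𝟙 {K} m j j≤m K≤j K≤m-j = ⊛-cancelʳ-≈ (qbinom m j ⊛ P m) 𝟙 (P m) P0≡1 (begin
  (qbinom m j ⊛ P m) ⊛ P m        ≈⟨ ⊛-cong-≈ (⊛-cong-≈ (≈-refl {K} {qbinom m j}) (poch-even-stable m j K≤m K≤j))
                                              (poch-even-stable m (m ℕ.∸ j) K≤m K≤m-j) ⟩
  (qbinom m j ⊛ P j) ⊛ P (m ℕ.∸ j) ≈⟨ ≋⇒≈ (qbinom-poch m j j≤m) ⟩
  P m                             ≈⟨ ≋⇒≈ (⊛-identityˡ (P m)) ⟨
  𝟙 ⊛ P m                         ∎)
  where
  open import Relation.Binary.Reasoning.Setoid ≈[ K ]-setoid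
  P : ℕ → FPS
  P = poch-even
  P0≡1 : poch-even m 0 ≡ + 1
  P0≡1 = ∏-head m (λ k → 1- q^ (2 ℕ.* suc k)) (λ k → refl)
  K≤m : K ≤ 2 ℕ.* suc m
  K≤m = ℕP.≤-trans K≤j (ℕP.*-monoʳ-≤ 2 (s≤s j≤m))

-- (j − a)², without truncated subtraction
sqDiff : ℕ → ℕ → ℕ
sqDiff zero    a       = a ℕ.* a
sqDiff (suc j) zero    = suc j ℕ.* suc j
sqDiff (suc j) (suc a) = sqDiff j a

sqDiff-+ˡ : ∀ a k → sqDiff (a ℕ.+ k) a ≡ k ℕ.* k
sqDiff-+ˡ zero    zero    = refl
sqDiff-+ˡ zero    (suc k) = refl
sqDiff-+ˡ (suc a) k       = sqDiff-+ˡ a k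

sqDiff-+ʳ : ∀ j t → sqDiff j (j ℕ.+ t) ≡ t ℕ.* t
sqDiff-+ʳ zero    t = refl
sqDiff-+ʳ (suc j) t = sqDiff-+ʳ j t

sqDiff-0-suc : ∀ a → sqDiff 0 (suc a) ≡ suc (2 ℕ.* a) ℕ.+ sqDiff 0 a
sqDiff-0-suc a = step a
  where
  step : ∀ a → suc a ℕ.* suc a ≡ suc (2 ℕ.* a) ℕ.+ a ℕ.* a
  step = ℕ-solve-∀

sqDiff-step-a : ∀ j a → sqDiff j a ℕ.+ 2 ℕ.* suc j ≡ suc (2 ℕ.* a) ℕ.+ sqDiff (suc j) a
sqDiff-step-a zero    zero    = refl
sqDiff-step-a zero    (suc a) = step a
  where
  step : ∀ a → suc a ℕ.* suc a ℕ.+ 2 ℕ.* 1 ≡ suc (2 ℕ.* suc a) ℕ.+ a ℕ.* a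
  step = ℕ-solve-∀
sqDiff-step-a (suc j) zero    = step j
  where
  step : ∀ j → suc j ℕ.* suc j ℕ.+ 2 ℕ.* suc (suc j) ≡ suc (2 ℕ.* 0) ℕ.+ suc (suc j) ℕ.* suc (suc j)
  step = ℕ-solve-∀
sqDiff-step-a (suc j) (suc a) = begin
  sqDiff j a ℕ.+ 2 ℕ.* suc (suc j)              ≡⟨ add-2 (sqDiff j a) j ⟩
  sqDiff j a ℕ.+ 2 ℕ.* suc j ℕ.+ 2              ≡⟨ cong (ℕ._+ 2) (sqDiff-step-a j a) ⟩
  suc (2 ℕ.* a) ℕ.+ sqDiff (suc j) a ℕ.+ 2      ≡⟨ add-2′ a (sqDiff (suc j) a) ⟩
  suc (2 ℕ.* suc a) ℕ.+ sqDiff (suc j) a        ∎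
  where
  open ≡-Reasoning
  add-2 : ∀ x j → x ℕ.+ 2 ℕ.* suc (suc j) ≡ x ℕ.+ 2 ℕ.* suc j ℕ.+ 2
  add-2 = ℕ-solve-∀
  add-2′ : ∀ a x → suc (2 ℕ.* a) ℕ.+ x ℕ.+ 2 ≡ suc (2 ℕ.* suc a) ℕ.+ x
  add-2′ = ℕ-solve-∀

sqDiff-step-b : ∀ j a b → j ≤ a ℕ.+ b →
                sqDiff (suc j) a ℕ.+ 2 ℕ.* (a ℕ.+ b ℕ.∸ j) ≡ suc (2 ℕ.* b) ℕ.+ sqDiff j a
sqDiff-step-b zero    zero    b _ = step b
  where
  step : ∀ b → 1 ℕ.* 1 ℕ.+ 2 ℕ.* b ≡ suc (2 ℕ.* b) ℕ.+ 0 ℕ.* 0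
  step = ℕ-solve-∀
sqDiff-step-b zero    (suc a) b _ = step a b
  where
  step : ∀ a b → a ℕ.* a ℕ.+ 2 ℕ.* (suc a ℕ.+ b) ≡ suc (2 ℕ.* b) ℕ.+ suc a ℕ.* suc a
  step = ℕ-solve-∀
sqDiff-step-b (suc j) zero    b j<b with ℕP.m≤n⇒∃[o]m+o≡n j<b
... | t , refl = trans (cong (λ x → suc (suc j) ℕ.* suc (suc j) ℕ.+ 2 ℕ.* x) (ℕP.m+n∸m≡n (suc j) t)) (step j t)
  where
  step : ∀ j t → suc (suc j) ℕ.* suc (suc j) ℕ.+ 2 ℕ.* t ≡ suc (2 ℕ.* (suc j ℕ.+ t)) ℕ.+ suc j ℕ.* suc j
  step = ℕ-solve-∀
sqDiff-step-b (suc j) (suc a) b (s≤s j≤a+b) = sqDiff-step-b j a b j≤a+b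

-- the value at z = −1 of the polynomial Σ_{j ≤ M} C j zʲ
altSum : (ℕ → FPS) → ℕ → FPS
altSum C zero    = C 0
altSum C (suc M) = C 0 ⊕ ⊝ altSum (C ∘ suc) M

altSum-cong : ∀ {C D} M → (∀ j → C j ≋ D j) → altSum C M ≋ altSum D M
altSum-cong zero    C≋D = C≋D 0
altSum-cong (suc M) C≋D = ⊕-cong (C≋D 0) (⊝-cong (altSum-cong M (C≋D ∘ suc)))

altSum-cong-≈ : ∀ {K} C D M → (∀ j → j ≤ M → C j ≈[ K ] D j) → altSum C M ≈[ K ] altSum D M
altSum-cong-≈ C D zero    C≈D = C≈D 0 z≤n
altSum-cong-≈ C D (suc M) C≈D =
  ⊕-cong-≈ (C≈D 0 z≤n) (⊝-cong-≈ (altSum-cong-≈ (C ∘ suc) (D ∘ suc) M (λ j j≤M → C≈D (suc j) (s≤s j≤M))))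

altSum-linear : ∀ C D x M → altSum (λ j → C j ⊕ x ⊛ D j) M ≋ altSum C M ⊕ x ⊛ altSum D M
altSum-linear C D x zero    = ≋-refl
altSum-linear C D x (suc M) =
  ≋-trans (⊕-congˡ (C 0 ⊕ x ⊛ D 0) (⊝-cong (altSum-linear (C ∘ suc) (D ∘ suc) x M)))
          (regroup (C 0) (D 0) (altSum (C ∘ suc) M) x (altSum (D ∘ suc) M))
  where
  regroup : ∀ a b c x y → (a ⊕ x ⊛ b) ⊕ ⊝ (c ⊕ x ⊛ y) ≋ (a ⊕ ⊝ c) ⊕ x ⊛ (b ⊕ ⊝ y)
  regroup = solve 5 (λ a b c x y → (a :+ x :* b) :- (c :+ x :* y) := (a :- c) :+ x :* (b :- y)) ≋-refl

altSum-⊛ : ∀ C P M → altSum (λ j → C j ⊛ P) M ≋ altSum C M ⊛ P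
altSum-⊛ C P zero    = ≋-refl
altSum-⊛ C P (suc M) = ≋-trans (⊕-congˡ (C 0 ⊛ P) (⊝-cong (altSum-⊛ (C ∘ suc) P M)))
  (solve 3 (λ c v p → c :* p :- v :* p := (c :- v) :* p) ≋-refl (C 0) (altSum (C ∘ suc) M) P)

altSum-drop-last : ∀ C M → C (suc M) ≋ 𝟘 → altSum C (suc M) ≋ altSum C M
altSum-drop-last C zero    C1≋𝟘 = ≋-trans (⊕-congˡ (C 0) (⊝-cong C1≋𝟘)) (λ n → ℤP.+-identityʳ (C 0 n))
altSum-drop-last C (suc M) C≋𝟘 = ⊕-congˡ (C 0) (⊝-cong (altSum-drop-last (C ∘ suc) M C≋𝟘))

altSum-1+xz : ∀ C C′ x M → C′ 0 ≋ C 0 → (∀ j → C′ (suc j) ≋ C (suc j) ⊕ x ⊛ C j) → C (suc M) ≋ 𝟘 →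
              altSum C′ (suc M) ≋ (1- x) ⊛ altSum C M
altSum-1+xz C C′ x M C′0 C′suc C≋𝟘 = begin
  C′ 0 ⊕ ⊝ altSum (C′ ∘ suc) M
    ≈⟨ ⊕-cong C′0 (⊝-cong (altSum-cong M C′suc)) ⟩
  C 0 ⊕ ⊝ altSum (λ j → C (suc j) ⊕ x ⊛ C j) M
    ≈⟨ ⊕-congˡ (C 0) (⊝-cong (altSum-linear (C ∘ suc) C x M)) ⟩
  C 0 ⊕ ⊝ (altSum (C ∘ suc) M ⊕ x ⊛ altSum C M)
    ≈⟨ regroup (C 0) (altSum (C ∘ suc) M) x (altSum C M) ⟩
  altSum C (suc M) ⊕ ⊝ (x ⊛ altSum C M)
    ≈⟨ ⊕-congʳ (⊝ (x ⊛ altSum C M)) (altSum-drop-last C M C≋𝟘) ⟩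
  altSum C M ⊕ ⊝ (x ⊛ altSum C M)
    ≈⟨ factor-out x (altSum C M) ⟩
  (1- x) ⊛ altSum C M ∎
  where
  open import Relation.Binary.Reasoning.Setoid ≋-setoid
  regroup : ∀ c v x w → c ⊕ ⊝ (v ⊕ x ⊛ w) ≋ (c ⊕ ⊝ v) ⊕ ⊝ (x ⊛ w)
  regroup = solve 4 (λ c v x w → c :- (v :+ x :* w) := (c :- v) :- x :* w) ≋-refl
  factor-out : ∀ x w → w ⊕ ⊝ (x ⊛ w) ≋ (1- x) ⊛ w
  factor-out = solve 2 (λ x w → w :- x :* w := (con (+ 1) :- x) :* w) ≋-refl

altSum-z+x : ∀ C C′ x M → C′ 0 ≋ x ⊛ C 0 → (∀ j → C′ (suc j) ≋ C j ⊕ x ⊛ C (suc j)) → C (suc M) ≋ 𝟘 →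
             altSum C′ (suc M) ≋ ⊝ ((1- x) ⊛ altSum C M)
altSum-z+x C C′ x M C′0 C′suc C≋𝟘 = begin
  C′ 0 ⊕ ⊝ altSum (C′ ∘ suc) M
    ≈⟨ ⊕-cong C′0 (⊝-cong (altSum-cong M C′suc)) ⟩
  x ⊛ C 0 ⊕ ⊝ altSum (λ j → C j ⊕ x ⊛ C (suc j)) M
    ≈⟨ ⊕-congˡ (x ⊛ C 0) (⊝-cong (altSum-linear C (C ∘ suc) x M)) ⟩
  x ⊛ C 0 ⊕ ⊝ (altSum C M ⊕ x ⊛ altSum (C ∘ suc) M)
    ≈⟨ regroup (C 0) (altSum C M) x (altSum (C ∘ suc) M) ⟩
  ⊝ altSum C M ⊕ x ⊛ altSum C (suc M)
    ≈⟨ ⊕-congˡ (⊝ altSum C M) (⊛-congˡ x (altSum-drop-last C M C≋𝟘)) ⟩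
  ⊝ altSum C M ⊕ x ⊛ altSum C M
    ≈⟨ factor-out x (altSum C M) ⟩
  ⊝ ((1- x) ⊛ altSum C M) ∎
  where
  open import Relation.Binary.Reasoning.Setoid ≋-setoid
  regroup : ∀ c w x v → x ⊛ c ⊕ ⊝ (w ⊕ x ⊛ v) ≋ ⊝ w ⊕ x ⊛ (c ⊕ ⊝ v)
  regroup = solve 4 (λ c w x v → x :* c :- (w :+ x :* v) := :- w :+ x :* (c :- v)) ≋-refl
  factor-out : ∀ x w → ⊝ w ⊕ x ⊛ w ≋ ⊝ ((1- x) ⊛ w)
  factor-out = solve 2 (λ x w → :- w :+ x :* w := :- ((con (+ 1) :- x) :* w)) ≋-refl

sign : ℕ → FPS
sign zero    = 𝟙
sign (suc n) = ⊝ sign n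

sign-sq : ∀ n → sign n ⊛ sign n ≋ 𝟙
sign-sq zero    = ⊛-identityˡ 𝟙
sign-sq (suc n) = ≋-trans (solve 1 (λ s → (:- s) :* (:- s) := s :* s) ≋-refl (sign n)) (sign-sq n)

sign-odd : ∀ n → sign (suc (n ℕ.+ n)) ≋ ⊝ 𝟙
sign-odd zero    = ≋-refl
sign-odd (suc n) = begin
  sign (suc (suc n ℕ.+ suc n))      ≡⟨ cong (λ m → sign (suc (suc m))) (ℕP.+-suc n n) ⟩
  ⊝ ⊝ sign (suc (n ℕ.+ n))          ≈⟨ (λ k → ℤP.neg-involutive (sign (suc (n ℕ.+ n)) k)) ⟩
  sign (suc (n ℕ.+ n))              ≈⟨ sign-odd n ⟩
  ⊝ 𝟙                               ∎
  where open import Relation.Binary.Reasoning.Setoid ≋-setoid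

sign-cancel : ∀ n f → sign n ⊛ (sign n ⊛ f) ≋ f
sign-cancel n f = ≋-trans (≋-sym (⊛-assoc (sign n) (sign n) f)) (≋-trans (⊛-congʳ f (sign-sq n)) (⊛-identityˡ f))

sgn-suc : ∀ m → sgn (suc m) ≡ - sgn m
sgn-suc zero          = refl
sgn-suc (suc zero)    = refl
sgn-suc (suc (suc m)) = trans (sgn-+2 (suc m)) (trans (sgn-suc m) (cong -_ (sym (sgn-+2 m))))
  where
  sgn-+2 : ∀ m → sgn (suc (suc m)) ≡ sgn m
  sgn-+2 m = cong (λ r → if r ≡ᵇ 0 then + 1 else - (+ 1)) (trans (cong (_% 2) (ℕP.+-comm 2 m)) ([m+n]%n≡m%n m 2))

sign≋ι-sgn : ∀ k → sign k ≋ ι (sgn k)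
sign≋ι-sgn zero    = ≋-refl
sign≋ι-sgn (suc k) = ≋-trans (⊝-cong (sign≋ι-sgn k)) (λ { zero → sym (sgn-suc k) ; (suc n) → refl })

q^-exchange : ∀ {a b c d} → a ℕ.+ b ≡ c ℕ.+ d → q^ a ⊛ q^ b ≋ q^ c ⊛ q^ d
q^-exchange {a} {b} {c} {d} eq = ≋-trans (≋-sym (q^-+ a b)) (≋-trans (≋-reflexive (cong q^_ eq)) (q^-+ c d))

distribˡ-assoc : ∀ u X w Y → u ⊛ (X ⊕ w ⊛ Y) ≋ u ⊛ X ⊕ (u ⊛ w) ⊛ Y
distribˡ-assoc = solve 4 (λ u X w Y → u :* (X :+ w :* Y) := u :* X :+ (u :* w) :* Y) ≋-refl

-- the coefficient of zʲ in ∏_{k<a} (z + q^(2k+1)) · ∏_{k<b} (1 + z q^(2k+1))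
jacobiTerm : ℕ → ℕ → ℕ → FPS
jacobiTerm a b j = q^ sqDiff j a ⊛ qbinom (a ℕ.+ b) j

jacobiTerm-top : ∀ a b → jacobiTerm a b (suc (a ℕ.+ b)) ≋ 𝟘
jacobiTerm-top a b = ≋-trans (⊛-congˡ (q^ sqDiff (suc (a ℕ.+ b)) a) (qbinom-> (a ℕ.+ b) (suc (a ℕ.+ b)) ℕP.≤-refl))
                             (⊛-zeroʳ (q^ sqDiff (suc (a ℕ.+ b)) a))

jacobiTerm-b-suc : ∀ a b j → jacobiTerm a (suc b) (suc j) ≋ jacobiTerm a b (suc j) ⊕ q^ suc (2 ℕ.* b) ⊛ jacobiTerm a b j
jacobiTerm-b-suc a b j = begin
  u ⊛ qbinom (a ℕ.+ suc b) (suc j)            ≡⟨ cong (λ m → u ⊛ qbinom m (suc j)) (ℕP.+-suc a b) ⟩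
  u ⊛ (qbinom (a ℕ.+ b) (suc j) ⊕ w ⊛ Y)      ≈⟨ distribˡ-assoc u (qbinom (a ℕ.+ b) (suc j)) w Y ⟩
  jacobiTerm a b (suc j) ⊕ (u ⊛ w) ⊛ Y        ≈⟨ ⊕-congˡ (jacobiTerm a b (suc j)) shifted ⟩
  jacobiTerm a b (suc j) ⊕ q^ suc (2 ℕ.* b) ⊛ jacobiTerm a b j ∎
  where
  open import Relation.Binary.Reasoning.Setoid ≋-setoid
  u : FPS
  u = q^ sqDiff (suc j) a
  w : FPS
  w = p^ (a ℕ.+ b ℕ.∸ j)
  Y : FPS
  Y = qbinom (a ℕ.+ b) j
  shifted : (u ⊛ w) ⊛ Y ≋ q^ suc (2 ℕ.* b) ⊛ (q^ sqDiff j a ⊛ Y)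
  shifted with j ℕP.≤? a ℕ.+ b
  ... | yes j≤a+b = ≋-trans (⊛-congʳ Y (q^-exchange (sqDiff-step-b j a b j≤a+b))) (⊛-assoc _ _ Y)
  ... | no  j≰a+b = both-zero (u ⊛ w) (q^ suc (2 ℕ.* b)) Y≋𝟘 (≋-trans (⊛-congˡ (q^ sqDiff j a) Y≋𝟘) (⊛-zeroʳ _))
    where
    Y≋𝟘 : Y ≋ 𝟘
    Y≋𝟘 = qbinom-> (a ℕ.+ b) j (ℕP.≰⇒> j≰a+b)

jacobiTerm-a-zero : ∀ a b → jacobiTerm (suc a) b 0 ≋ q^ suc (2 ℕ.* a) ⊛ jacobiTerm a b 0
jacobiTerm-a-zero a b = ≋-trans (⊛-congʳ 𝟙 (≋-trans (≋-reflexive (cong q^_ (sqDiff-0-suc a))) (q^-+ (suc (2 ℕ.* a)) (sqDiff 0 a))))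
                                (⊛-assoc (q^ suc (2 ℕ.* a)) (q^ sqDiff 0 a) 𝟙)

jacobiTerm-a-suc : ∀ a b j → jacobiTerm (suc a) b (suc j) ≋ jacobiTerm a b j ⊕ q^ suc (2 ℕ.* a) ⊛ jacobiTerm a b (suc j)
jacobiTerm-a-suc a b j = begin
  u ⊛ qbinom (suc (a ℕ.+ b)) (suc j)                         ≈⟨ ⊛-congˡ u (qbinom-pascal′ (a ℕ.+ b) j) ⟩
  u ⊛ (binom ⊕ p^ suc j ⊛ qbinom (a ℕ.+ b) (suc j))    ≈⟨ distribˡ-assoc u _ (p^ suc j) _ ⟩
  u ⊛ binom ⊕ (u ⊛ p^ suc j) ⊛ qbinom (a ℕ.+ b) (suc j) ≈⟨ ⊕-congˡ (u ⊛ binom) shifted ⟩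
  jacobiTerm a b j ⊕ q^ suc (2 ℕ.* a) ⊛ jacobiTerm a b (suc j) ∎
  where
  open import Relation.Binary.Reasoning.Setoid ≋-setoid
  u : FPS
  u = q^ sqDiff j a
  binom : FPS
  binom = qbinom (a ℕ.+ b) j
  shifted : (u ⊛ p^ suc j) ⊛ qbinom (a ℕ.+ b) (suc j) ≋ q^ suc (2 ℕ.* a) ⊛ jacobiTerm a b (suc j)
  shifted = ≋-trans (⊛-congʳ _ (q^-exchange (sqDiff-step-a j a))) (⊛-assoc _ _ _)

finite-jacobi : ∀ a b → altSum (jacobiTerm a b) (a ℕ.+ b) ≋ (sign a ⊛ poch-odd a) ⊛ poch-odd b
finite-jacobi zero    zero    = ≋-trans (⊛-congʳ 𝟙 q^0≋𝟙) (solve 0 (con (+ 1) :* con (+ 1) := (con (+ 1) :* con (+ 1)) :* con (+ 1)) ≋-refl)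
finite-jacobi (suc a) zero    = begin
  altSum (jacobiTerm (suc a) 0) (suc (a ℕ.+ 0))
    ≈⟨ altSum-z+x (jacobiTerm a 0) (jacobiTerm (suc a) 0) x (a ℕ.+ 0)
         (jacobiTerm-a-zero a 0) (jacobiTerm-a-suc a 0) (jacobiTerm-top a 0) ⟩
  ⊝ ((1- x) ⊛ altSum (jacobiTerm a 0) (a ℕ.+ 0))
    ≈⟨ ⊝-cong (⊛-congˡ (1- x) (finite-jacobi a zero)) ⟩
  ⊝ ((1- x) ⊛ ((sign a ⊛ poch-odd a) ⊛ 𝟙))
    ≈⟨ regroup (sign a) (poch-odd a) (1- x) 𝟙 ⟩
  (sign (suc a) ⊛ poch-odd (suc a)) ⊛ 𝟙 ∎
  where
  open import Relation.Binary.Reasoning.Setoid ≋-setoid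
  x : FPS
  x = q^ suc (2 ℕ.* a)
  regroup : ∀ s o f u → ⊝ (f ⊛ ((s ⊛ o) ⊛ u)) ≋ ((⊝ s) ⊛ (o ⊛ f)) ⊛ u
  regroup = solve 4 (λ s o f u → :- (f :* ((s :* o) :* u)) := ((:- s) :* (o :* f)) :* u) ≋-refl
finite-jacobi a       (suc b) = begin
  altSum (jacobiTerm a (suc b)) (a ℕ.+ suc b)
    ≡⟨ cong (altSum (jacobiTerm a (suc b))) (ℕP.+-suc a b) ⟩
  altSum (jacobiTerm a (suc b)) (suc (a ℕ.+ b))
    ≈⟨ altSum-1+xz (jacobiTerm a b) (jacobiTerm a (suc b)) x (a ℕ.+ b)
         ≋-refl (jacobiTerm-b-suc a b) (jacobiTerm-top a b) ⟩
  (1- x) ⊛ altSum (jacobiTerm a b) (a ℕ.+ b)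
    ≈⟨ ⊛-congˡ (1- x) (finite-jacobi a b) ⟩
  (1- x) ⊛ ((sign a ⊛ poch-odd a) ⊛ poch-odd b)
    ≈⟨ regroup (sign a ⊛ poch-odd a) (poch-odd b) (1- x) ⟩
  (sign a ⊛ poch-odd a) ⊛ poch-odd (suc b) ∎
  where
  open import Relation.Binary.Reasoning.Setoid ≋-setoid
  x : FPS
  x = q^ suc (2 ℕ.* b)
  regroup : ∀ s o f → f ⊛ (s ⊛ o) ≋ s ⊛ (o ⊛ f)
  regroup = solve 3 (λ s o f → f :* (s :* o) := s :* (o :* f)) ≋-refl

altSum-snoc : ∀ C M → altSum C (suc M) ≋ altSum C M ⊕ sign (suc M) ⊛ C (suc M)
altSum-snoc C zero    = solve 2 (λ a b → a :- b := a :+ (:- con (+ 1)) :* b) ≋-refl (C 0) (C 1)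
altSum-snoc C (suc M) = ≋-trans (⊕-congˡ (C 0) (⊝-cong (altSum-snoc (C ∘ suc) M)))
  (solve 4 (λ c v s d → c :- (v :+ s :* d) := (c :- v) :+ (:- s) :* d) ≋-refl
     (C 0) (altSum (C ∘ suc) M) (sign (suc M)) (C (suc (suc M))))

thetaTail : ℕ → FPS
thetaTail zero    = 𝟘
thetaTail (suc n) = thetaTail n ⊕ sign (suc n) ⊛ q^ (suc n ℕ.* suc n)

thetaPartial : ℕ → FPS
thetaPartial n = 𝟙 ⊕ ι (+ 2) ⊛ thetaTail n

altSum-q^sqDiff : ∀ n → altSum (λ j → q^ sqDiff j n) (n ℕ.+ n) ≋ sign n ⊛ thetaPartial n
altSum-q^sqDiff zero    = ≋-trans q^0≋𝟙 (≋-sym (≋-trans (⊛-identityˡ (thetaPartial 0)) 𝟙⊕2⊛𝟘))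
  where
  𝟙⊕2⊛𝟘 : 𝟙 ⊕ ι (+ 2) ⊛ 𝟘 ≋ 𝟙
  𝟙⊕2⊛𝟘 k = trans (cong (λ x → 𝟙 k + x) (⊛-zeroʳ (ι (+ 2)) k)) (ℤP.+-identityʳ (𝟙 k))
altSum-q^sqDiff (suc n) = begin
  Q ⊕ ⊝ altSum D (n ℕ.+ suc n)
    ≡⟨ cong (λ m → Q ⊕ ⊝ altSum D m) (ℕP.+-suc n n) ⟩
  Q ⊕ ⊝ altSum D (suc (n ℕ.+ n))
    ≈⟨ ⊕-congˡ Q (⊝-cong (altSum-snoc D (n ℕ.+ n))) ⟩
  Q ⊕ ⊝ (altSum D (n ℕ.+ n) ⊕ sign (suc (n ℕ.+ n)) ⊛ D (suc (n ℕ.+ n)))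
    ≈⟨ ⊕-congˡ Q (⊝-cong (⊕-cong (altSum-q^sqDiff n) (⊛-cong (sign-odd n) D-last))) ⟩
  Q ⊕ ⊝ (s ⊛ thetaPartial n ⊕ (⊝ 𝟙) ⊛ Q)
    ≈⟨ regroup s (thetaPartial n) Q ⟩
  ⊝ (s ⊛ thetaPartial n) ⊕ (ι (+ 2) ⊛ 𝟙) ⊛ Q
    ≈⟨ ⊕-congˡ (⊝ (s ⊛ thetaPartial n)) (⊛-congʳ Q (⊛-congˡ (ι (+ 2)) (≋-sym (sign-sq n)))) ⟩
  ⊝ (s ⊛ thetaPartial n) ⊕ (ι (+ 2) ⊛ (s ⊛ s)) ⊛ Q
    ≈⟨ regroup′ s (thetaTail n) Q ⟩
  ⊝ s ⊛ thetaPartial (suc n) ∎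
  where
  open import Relation.Binary.Reasoning.Setoid ≋-setoid
  D : ℕ → FPS
  D j = q^ sqDiff j n
  Q : FPS
  Q = q^ (suc n ℕ.* suc n)
  s : FPS
  s = sign n
  D-last : D (suc (n ℕ.+ n)) ≋ Q
  D-last = ≋-reflexive (cong q^_ (trans (cong (λ j → sqDiff j n) (sym (ℕP.+-suc n n))) (sqDiff-+ˡ n (suc n))))
  regroup : ∀ s θ Q → Q ⊕ ⊝ (s ⊛ θ ⊕ (⊝ 𝟙) ⊛ Q) ≋ ⊝ (s ⊛ θ) ⊕ (ι (+ 2) ⊛ 𝟙) ⊛ Q
  regroup = solve 3 (λ s θ Q → Q :- (s :* θ :+ (:- con (+ 1)) :* Q) :=
                               :- (s :* θ) :+ (con (+ 2) :* con (+ 1)) :* Q) ≋-refl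
  regroup′ : ∀ s t Q → ⊝ (s ⊛ (𝟙 ⊕ ι (+ 2) ⊛ t)) ⊕ (ι (+ 2) ⊛ (s ⊛ s)) ⊛ Q ≋ ⊝ s ⊛ (𝟙 ⊕ ι (+ 2) ⊛ (t ⊕ ⊝ s ⊛ Q))
  regroup′ = solve 3 (λ s t Q → :- (s :* (con (+ 1) :+ con (+ 2) :* t)) :+ (con (+ 2) :* (s :* s)) :* Q :=
                                (:- s) :* (con (+ 1) :+ con (+ 2) :* (t :+ (:- s) :* Q))) ≋-refl

q^⊛qbinom⊛poch-even-≈ : ∀ {L} K d m j → j ≤ m → K ≤ 2 ℕ.* suc j → K ≤ 2 ℕ.* suc (m ℕ.∸ j) → L ≤ d ℕ.+ K →
                        (q^ d ⊛ qbinom m j) ⊛ poch-even m ≈[ L ] q^ d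
q^⊛qbinom⊛poch-even-≈ K d m j j≤m K≤j K≤m-j L≤d+K =
  ≈-trans (≋⇒≈ (⊛-assoc (q^ d) (qbinom m j) (poch-even m)))
  (≈-trans (≈-weaken L≤d+K (q^-⊛-cong-≈ d (qbinom⊛poch-even-≈𝟙 m j j≤m K≤j K≤m-j)))
           (≋⇒≈ (⊛-identityʳ (q^ d))))

centre-bound : ∀ a t → suc ((a ℕ.+ t) ℕ.+ (a ℕ.+ t)) ≤ t ℕ.* t ℕ.+ 2 ℕ.* suc a
centre-bound a zero    = ℕP.≤-trans (ℕP.n≤1+n _) (ℕP.≤-reflexive (eq a))
  where
  eq : ∀ a → suc (suc ((a ℕ.+ 0) ℕ.+ (a ℕ.+ 0))) ≡ 0 ℕ.* 0 ℕ.+ 2 ℕ.* suc a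
  eq = ℕ-solve-∀
centre-bound a (suc u) = ℕP.≤-trans (ℕP.m≤m+n _ (u ℕ.* u)) (ℕP.≤-reflexive (eq a u))
  where
  eq : ∀ a u → suc ((a ℕ.+ suc u) ℕ.+ (a ℕ.+ suc u)) ℕ.+ u ℕ.* u ≡ suc u ℕ.* suc u ℕ.+ 2 ℕ.* suc a
  eq = ℕ-solve-∀

-- [2n choose j]_{q²} (q²;q²)_{2n} ≡ 1 holds only modulo p^(1 + min(j, 2n − j)); the factor
-- q^((j − n)²) makes up the difference to q^(2n+1).
jacobiTerm-truncation : ∀ n j → j ≤ n ℕ.+ n →
                        jacobiTerm n n j ⊛ poch-even (n ℕ.+ n) ≈[ suc (n ℕ.+ n) ] q^ sqDiff j n
jacobiTerm-truncation n j j≤2n with ℕP.≤-total j n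
... | inj₁ j≤n = left (ℕP.m≤n⇒∃[o]m+o≡n j≤n) j≤2n
  where
  left : ∀ {j n} → (∃ λ t → j ℕ.+ t ≡ n) → j ≤ n ℕ.+ n →
         jacobiTerm n n j ⊛ poch-even (n ℕ.+ n) ≈[ suc (n ℕ.+ n) ] q^ sqDiff j n
  left {j} (t , refl) j≤2n = q^⊛qbinom⊛poch-even-≈ (2 ℕ.* suc j) (sqDiff j (j ℕ.+ t)) ((j ℕ.+ t) ℕ.+ (j ℕ.+ t)) j j≤2n
    ℕP.≤-refl
    (ℕP.*-monoʳ-≤ 2 (s≤s (ℕP.≤-trans (ℕP.m≤m+n j t) (ℕP.≤-trans (ℕP.m≤n+m (j ℕ.+ t) t) (ℕP.≤-reflexive (sym 2n∸j≡))))))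
    (ℕP.≤-trans (centre-bound j t) (ℕP.≤-reflexive (cong (ℕ._+ 2 ℕ.* suc j) (sym (sqDiff-+ʳ j t)))))
    where
    2n∸j≡ : (j ℕ.+ t) ℕ.+ (j ℕ.+ t) ℕ.∸ j ≡ t ℕ.+ (j ℕ.+ t)
    2n∸j≡ = trans (cong (ℕ._∸ j) (ℕP.+-assoc j t (j ℕ.+ t))) (ℕP.m+n∸m≡n j (t ℕ.+ (j ℕ.+ t)))
... | inj₂ n≤j = right (ℕP.m≤n⇒∃[o]m+o≡n n≤j) j≤2n
  where
  right : ∀ {j n} → (∃ λ s → n ℕ.+ s ≡ j) → j ≤ n ℕ.+ n →
          jacobiTerm n n j ⊛ poch-even (n ℕ.+ n) ≈[ suc (n ℕ.+ n) ] q^ sqDiff j n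
  right {n = n} (s , refl) j≤2n with ℕP.m≤n⇒∃[o]m+o≡n (ℕP.+-cancelˡ-≤ n s n j≤2n)
  ... | r , refl = q^⊛qbinom⊛poch-even-≈ (2 ℕ.* suc r) (sqDiff ((s ℕ.+ r) ℕ.+ s) (s ℕ.+ r)) ((s ℕ.+ r) ℕ.+ (s ℕ.+ r))
    ((s ℕ.+ r) ℕ.+ s) j≤2n
    (ℕP.*-monoʳ-≤ 2 (s≤s (ℕP.≤-trans (ℕP.m≤n+m r s) (ℕP.m≤m+n (s ℕ.+ r) s))))
    (ℕP.≤-reflexive (cong (λ x → 2 ℕ.* suc x) (sym 2n∸j≡r)))
    (ℕP.≤-trans (ℕP.≤-reflexive (cong (λ x → suc (x ℕ.+ x)) (ℕP.+-comm s r)))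
      (ℕP.≤-trans (centre-bound r s) (ℕP.≤-reflexive (cong (ℕ._+ 2 ℕ.* suc r) (sym (sqDiff-+ˡ (s ℕ.+ r) s))))))
    where
    regroup : ∀ s r → (s ℕ.+ r) ℕ.+ (s ℕ.+ r) ≡ ((s ℕ.+ r) ℕ.+ s) ℕ.+ r
    regroup = ℕ-solve-∀
    2n∸j≡r : (s ℕ.+ r) ℕ.+ (s ℕ.+ r) ℕ.∸ ((s ℕ.+ r) ℕ.+ s) ≡ r
    2n∸j≡r = trans (cong (ℕ._∸ ((s ℕ.+ r) ℕ.+ s)) (regroup s r)) (ℕP.m+n∸m≡n ((s ℕ.+ r) ℕ.+ s) r)

poch-odd²⊛poch-even-≈ : ∀ n → (poch-odd n ⊛ poch-odd n) ⊛ poch-even (n ℕ.+ n) ≈[ suc (n ℕ.+ n) ] thetaPartial n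
poch-odd²⊛poch-even-≈ n = begin
  (o ⊛ o) ⊛ P                                 ≈⟨ ≋⇒≈ (sign-cancel n ((o ⊛ o) ⊛ P)) ⟨
  s ⊛ (s ⊛ ((o ⊛ o) ⊛ P))                     ≈⟨ ≋⇒≈ (⊛-congˡ s (regroup s o P)) ⟩
  s ⊛ (((s ⊛ o) ⊛ o) ⊛ P)                     ≈⟨ ≋⇒≈ (⊛-congˡ s (⊛-congʳ P (finite-jacobi n n))) ⟨
  s ⊛ (altSum (jacobiTerm n n) (n ℕ.+ n) ⊛ P)  ≈⟨ ≋⇒≈ (⊛-congˡ s (altSum-⊛ (jacobiTerm n n) P (n ℕ.+ n))) ⟨
  s ⊛ altSum (λ j → jacobiTerm n n j ⊛ P) (n ℕ.+ n)
    ≈⟨ ⊛-cong-≈ (≈-refl {f = s}) (altSum-cong-≈ _ _ (n ℕ.+ n) (jacobiTerm-truncation n)) ⟩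
  s ⊛ altSum (λ j → q^ sqDiff j n) (n ℕ.+ n)  ≈⟨ ≋⇒≈ (⊛-congˡ s (altSum-q^sqDiff n)) ⟩
  s ⊛ (s ⊛ thetaPartial n)                    ≈⟨ ≋⇒≈ (sign-cancel n (thetaPartial n)) ⟩
  thetaPartial n                              ∎
  where
  open import Relation.Binary.Reasoning.Setoid ≈[ suc (n ℕ.+ n) ]-setoid
  s : FPS
  s = sign n
  o : FPS
  o = poch-odd n
  P : FPS
  P = poch-even (n ℕ.+ n)
  regroup : ∀ s o P → s ⊛ ((o ⊛ o) ⊛ P) ≋ ((s ⊛ o) ⊛ o) ⊛ P
  regroup = solve 3 (λ s o P → s :* ((o :* o) :* P) := ((s :* o) :* o) :* P) ≋-refl

hit-q^ : ∀ x E c → hit (+ x) E c ≡ c * (q^ x) E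
hit-q^ x E c with x ℕP.≟ E | E ≡ᵇ x in E≡ᵇx
... | yes refl | true  = sym (ℤP.*-identityʳ c)
... | yes refl | false = ⊥-elim (subst T E≡ᵇx (ℕP.≡⇒≡ᵇ x x refl))
... | no x≢E   | true  = ⊥-elim (x≢E (sym (ℕP.≡ᵇ⇒≡ E x (subst T (sym E≡ᵇx) tt))))
... | no _     | false = sym (ℤP.*-zeroʳ c)

hit-> : ∀ x E c → E < x → hit (+ x) E c ≡ + 0
hit-> x E c E<x = trans (hit-q^ x E c) (trans (cong (c *_) (q^-< x E E<x)) (ℤP.*-zeroʳ c))

hit-neg : ∀ e E c → hit e E (- c) ≡ - hit e E c
hit-neg e E c with ⌊ e ℤP.≟ + E ⌋
... | true  = refl
... | false = refl

-- Σ_{m ≥ 1} (−1)ᵐ q^(m²), in the finite form of S2bar: q^(m²) does not reach q^E once m > E + 1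
θ⁺ : FPS
θ⁺ E = Σ< (suc (suc E)) (λ k → hit (+ (suc k ℕ.* suc k)) E (sgn (suc k)))

θ : FPS
θ = 𝟙 ⊕ ι (+ 2) ⊛ θ⁺

thetaTail-coeff : ∀ n E → thetaTail n E ≡ Σ< n (λ k → hit (+ (suc k ℕ.* suc k)) E (sgn (suc k)))
thetaTail-coeff zero    E = refl
thetaTail-coeff (suc n) E = begin
  thetaTail n E + (sign (suc n) ⊛ Q) E              ≡⟨ cong₂ _+_ (thetaTail-coeff n E) (⊛-congʳ Q (sign≋ι-sgn (suc n)) E) ⟩
  Σ< n g + (ι (sgn (suc n)) ⊛ Q) E                 ≡⟨ cong (λ x → Σ< n g + x) (trans (ι-⊛ (sgn (suc n)) Q E) (sym (hit-q^ (suc n ℕ.* suc n) E (sgn (suc n))))) ⟩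
  Σ< n g + g n                                     ≡⟨ Σ<-snoc n g ⟨
  Σ< (suc n) g                                     ∎
  where
  open ≡-Reasoning
  Q : FPS
  Q = q^ (suc n ℕ.* suc n)
  g : ℕ → ℤ
  g k = hit (+ (suc k ℕ.* suc k)) E (sgn (suc k))

thetaTail-≈θ⁺ : ∀ n → thetaTail n ≈[ suc (n ℕ.+ n) ] θ⁺
thetaTail-≈θ⁺ n E E<2n+1 = trans (thetaTail-coeff n E) (Σ<-stable n (suc (suc E)) g
  (λ k n≤k → hit-> _ E _ (ℕP.<-≤-trans E<2n+1 (ℕP.≤-trans (2n+1≤[n+1]² n) (ℕP.*-mono-≤ (s≤s n≤k) (s≤s n≤k)))))
  (λ k E+2≤k → hit-> _ E _ (ℕP.<-≤-trans (ℕP.≤-trans (ℕP.n≤1+n (suc E)) E+2≤k) (ℕP.≤-trans (ℕP.n≤1+n k) (ℕP.m≤m*n (suc k) (suc k))))))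
  where
  g : ℕ → ℤ
  g k = hit (+ (suc k ℕ.* suc k)) E (sgn (suc k))
  2n+1≤[n+1]² : ∀ n → suc (n ℕ.+ n) ≤ suc n ℕ.* suc n
  2n+1≤[n+1]² n = ℕP.≤-trans (ℕP.m≤m+n (suc (n ℕ.+ n)) (n ℕ.* n)) (ℕP.≤-reflexive (eq n))
    where
    eq : ∀ n → suc (n ℕ.+ n) ℕ.+ n ℕ.* n ≡ suc n ℕ.* suc n
    eq = ℕ-solve-∀

thetaPartial-≈θ : ∀ n → thetaPartial n ≈[ suc (n ℕ.+ n) ] θ
thetaPartial-≈θ n = ⊕-cong-≈ (≈-refl {f = 𝟙}) (⊛-cong-≈ (≈-refl {f = ι (+ 2)}) (thetaTail-≈θ⁺ n))

poch-odd²⊛poch-even-≈θ : ∀ n → (poch-odd n ⊛ poch-odd n) ⊛ poch-even n ≈[ suc (n ℕ.+ n) ] θ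
poch-odd²⊛poch-even-≈θ n = begin
  (poch-odd n ⊛ poch-odd n) ⊛ poch-even n        ≈⟨ ⊛-cong-≈ (≈-refl {f = poch-odd n ⊛ poch-odd n})
                                                               (poch-even-grow n (n ℕ.+ n) (ℕP.m≤m+n n n) 2n+1≤2[n+1]) ⟨
  (poch-odd n ⊛ poch-odd n) ⊛ poch-even (n ℕ.+ n) ≈⟨ poch-odd²⊛poch-even-≈ n ⟩
  thetaPartial n                                 ≈⟨ thetaPartial-≈θ n ⟩
  θ                                              ∎
  where
  open import Relation.Binary.Reasoning.Setoid ≈[ suc (n ℕ.+ n) ]-setoid
  2n+1≤2[n+1] : suc (n ℕ.+ n) ≤ 2 ℕ.* suc n
  2n+1≤2[n+1] = ℕP.≤-trans (ℕP.n≤1+n _) (ℕP.≤-reflexive (eq n))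
    where
    eq : ∀ n → suc (suc (n ℕ.+ n)) ≡ 2 ℕ.* suc n
    eq = ℕ-solve-∀

poch-−q⊛θ-≈ : ∀ n → poch-−q (2 ℕ.* n) ⊛ θ ≈[ suc (n ℕ.+ n) ] poch-q (2 ℕ.* n)
poch-−q⊛θ-≈ n = begin
  M ⊛ θ                              ≈⟨ ⊛-cong-≈ (≈-refl {f = M}) (poch-odd²⊛poch-even-≈θ n) ⟨
  M ⊛ ((o ⊛ o) ⊛ poch-even n)        ≈⟨ ≋⇒≈ (regroup M o (poch-even n)) ⟩
  o ⊛ (M ⊛ (o ⊛ poch-even n))        ≈⟨ ≋⇒≈ (⊛-congˡ o (⊛-congˡ M (poch-q-double n))) ⟨
  o ⊛ (M ⊛ poch-q (2 ℕ.* n))         ≈⟨ ≋⇒≈ (⊛-congˡ o (poch-−q⊛poch-q (2 ℕ.* n))) ⟩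
  o ⊛ poch-even (2 ℕ.* n)            ≈⟨ ⊛-cong-≈ (≈-refl {f = o}) (poch-even-grow n (2 ℕ.* n) (ℕP.m≤n*m n 2) 2n+1≤2[n+1]) ⟩
  o ⊛ poch-even n                    ≈⟨ ≋⇒≈ (poch-q-double n) ⟨
  poch-q (2 ℕ.* n)                   ∎
  where
  open import Relation.Binary.Reasoning.Setoid ≈[ suc (n ℕ.+ n) ]-setoid
  M : FPS
  M = poch-−q (2 ℕ.* n)
  o : FPS
  o = poch-odd n
  2n+1≤2[n+1] : suc (n ℕ.+ n) ≤ 2 ℕ.* suc n
  2n+1≤2[n+1] = ℕP.≤-trans (ℕP.n≤1+n _) (ℕP.≤-reflexive (eq n))
    where
    eq : ∀ n → suc (suc (n ℕ.+ n)) ≡ 2 ℕ.* suc n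
    eq = ℕ-solve-∀
  regroup : ∀ m o p → m ⊛ ((o ⊛ o) ⊛ p) ≋ o ⊛ (m ⊛ (o ⊛ p))
  regroup = solve 3 (λ m o p → m :* ((o :* o) :* p) := o :* (m :* (o :* p))) ≋-refl

qPoch≋mqPoch⊛θ : qPoch ≋ mqPoch ⊛ θ
qPoch≋mqPoch⊛θ N = begin
  qPoch N                          ≡⟨ qPoch-coeff (2 ℕ.* suc N) N N<2[N+1] ⟩
  poch-q (2 ℕ.* suc N) N           ≡⟨ poch-−q⊛θ-≈ (suc N) N (s≤s (ℕP.≤-trans (ℕP.n≤1+n N) (ℕP.m≤m+n (suc N) (suc N)))) ⟨
  (poch-−q (2 ℕ.* suc N) ⊛ θ) N    ≡⟨ ⊛-cong-≈ {f = mqPoch} (λ E E≤N → mqPoch-coeff (2 ℕ.* suc N) E (ℕP.<-≤-trans E≤N N<2[N+1]))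
                                              (≈-refl {f = θ}) N ℕP.≤-refl ⟨
  (mqPoch ⊛ θ) N                   ∎
  where
  open ≡-Reasoning
  N<2[N+1] : N < 2 ℕ.* suc N
  N<2[N+1] = ℕP.≤-trans (ℕP.n≤1+n (suc N)) (ℕP.≤-trans (ℕP.m≤m+n (suc (suc N)) (N ℕ.+ 0)) (ℕP.≤-reflexive (eq N)))
    where
    eq : ∀ N → suc (suc N) ℕ.+ (N ℕ.+ 0) ≡ 2 ℕ.* suc N
    eq = ℕ-solve-∀

gauss : mul qPoch (inv mqPoch) ≋ θ
gauss = begin
  mul qPoch (inv mqPoch)       ≈⟨ mul≋⊛ qPoch (inv mqPoch) ⟩
  qPoch ⊛ inv mqPoch           ≈⟨ ⊛-congʳ (inv mqPoch) qPoch≋mqPoch⊛θ ⟩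
  (mqPoch ⊛ θ) ⊛ inv mqPoch    ≈⟨ swap mqPoch θ (inv mqPoch) ⟩
  (mqPoch ⊛ inv mqPoch) ⊛ θ    ≈⟨ ⊛-congʳ θ (inv-inverseʳ mqPoch refl) ⟩
  𝟙 ⊛ θ                        ≈⟨ ⊛-identityˡ θ ⟩
  θ                            ∎
  where
  open import Relation.Binary.Reasoning.Setoid ≋-setoid
  swap : ∀ m t i → (m ⊛ t) ⊛ i ≋ (m ⊛ i) ⊛ t
  swap = solve 3 (λ m t i → (m :* t) :* i := (m :* i) :* t) ≋-refl

θ-coeff : ∀ N → θ N ≡ one N + + 2 * θ⁺ N
θ-coeff N = cong₂ _+_ (sym (one≋𝟙 N)) (ι-⊛ (+ 2) θ⁺ N)

sum-map-upTo : ∀ f K → sum (map f (upTo K)) ≡ Σ< K f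
sum-map-upTo f K = cong sum (map-upTo f K)

sum-map-suc-upTo : ∀ f K → sum (map f (map suc (upTo K))) ≡ Σ< K (f ∘ suc)
sum-map-suc-upTo f K = cong sum (trans (cong (map f) (map-upTo suc K)) (map-applyUpTo suc f K))

-- The exponents are n² + 2ℓn(j+1) and n² − 2ℓn + 2ℓn(j+1) = n² + 2ℓnj.
S2bar-term-telescopes : ∀ ℓ n E → 1 ≤ ℓ → 1 ≤ n →
  Σ< (suc (suc E)) (λ j → hit (+ (n ℕ.* n ℕ.+ 2 ℕ.* ℓ ℕ.* n ℕ.+ 2 ℕ.* ℓ ℕ.* n ℕ.* j)) E (sgn n))
  + Σ< (suc (suc E)) (λ j → hit (+ (n ℕ.* n) ℤ.- + (2 ℕ.* ℓ ℕ.* n) + + (2 ℕ.* ℓ ℕ.* n ℕ.* suc j)) E (- sgn n))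
  ≡ - hit (+ (n ℕ.* n)) E (sgn n)
S2bar-term-telescopes (suc l) (suc m) E _ _ = begin
  Σ< K (λ j → hit (+ (n² ℕ.+ L ℕ.+ L ℕ.* j)) E s) + Σ< K (λ j → hit (+ n² ℤ.- + L + + (L ℕ.* suc j)) E (- s))
    ≡⟨ cong₂ _+_ (Σ<-cong K (λ j _ → cong (λ e → hit (+ e) E s) (shift-up j)))
                 (Σ<-cong K (λ j _ → trans (cong (λ e → hit e E (- s)) (shift-down j)) (hit-neg _ E s))) ⟩
  Σ< K (h ∘ suc) + Σ< K (λ j → - h j)  ≡⟨ Σ<-+ K (h ∘ suc) (λ j → - h j) ⟩
  Σ< K (λ j → h (suc j) + - h j)       ≡⟨ Σ<-telescope K h ⟩
  h K + - h 0                          ≡⟨ cong₂ (λ a b → a + - b) h-K≡0 h-0≡ ⟩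
  + 0 + - hit (+ n²) E s               ≡⟨ ℤP.+-identityˡ _ ⟩
  - hit (+ n²) E s                     ∎
  where
  open ≡-Reasoning
  K : ℕ
  K = suc (suc E)
  n² : ℕ
  n² = suc m ℕ.* suc m
  L : ℕ
  L = 2 ℕ.* suc l ℕ.* suc m
  s : ℤ
  s = sgn (suc m)
  h : ℕ → ℤ
  h j = hit (+ (n² ℕ.+ L ℕ.* j)) E s
  shift-up : ∀ j → n² ℕ.+ L ℕ.+ L ℕ.* j ≡ n² ℕ.+ L ℕ.* suc j
  shift-up j = trans (ℕP.+-assoc n² L (L ℕ.* j)) (cong (n² ℕ.+_) (sym (ℕP.*-suc L j)))
  cancel : ∀ a b c → a ℤ.- b + (b + c) ≡ a + c
  cancel = ℤ-solve-∀
  shift-down : ∀ j → + n² ℤ.- + L + + (L ℕ.* suc j) ≡ + (n² ℕ.+ L ℕ.* j)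
  shift-down j = begin
    + n² ℤ.- + L + + (L ℕ.* suc j)      ≡⟨ cong (λ x → + n² ℤ.- + L + x) (trans (cong +_ (ℕP.*-suc L j)) (ℤP.pos-+ L (L ℕ.* j))) ⟩
    + n² ℤ.- + L + (+ L + + (L ℕ.* j))  ≡⟨ cancel (+ n²) (+ L) (+ (L ℕ.* j)) ⟩
    + n² + + (L ℕ.* j)                  ≡⟨ ℤP.pos-+ n² (L ℕ.* j) ⟨
    + (n² ℕ.+ L ℕ.* j)                  ∎
  h-K≡0 : h K ≡ + 0
  h-K≡0 = hit-> _ E s (ℕP.≤-trans (ℕP.n≤1+n (suc E)) (ℕP.≤-trans (ℕP.m≤n*m K L) (ℕP.m≤n+m (L ℕ.* K) n²)))
  h-0≡ : h 0 ≡ hit (+ n²) E s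
  h-0≡ = cong (λ e → hit (+ e) E s) (trans (cong (n² ℕ.+_) (ℕP.*-zeroʳ L)) (ℕP.+-identityʳ n²))

S2bar-ℓ-ℓ : ∀ ℓ E → 1 ≤ ℓ → S2bar ℓ ℓ E ≡ - θ⁺ E
S2bar-ℓ-ℓ ℓ E 1≤ℓ = begin
  posPart ℓ ℓ E + negPart ℓ ℓ E
    ≡⟨ cong₂ _+_ (trans (sum-map-suc-upTo posSum K) (Σ<-cong K (λ k _ → sum-map-upTo (pos (suc k)) K)))
                 (trans (sum-map-suc-upTo negSum K) (Σ<-cong K (λ k _ → sum-map-suc-upTo (neg (suc k)) K))) ⟩
  Σ< K (λ k → Σ< K (pos (suc k))) + Σ< K (λ k → Σ< K (neg (suc k) ∘ suc))
    ≡⟨ Σ<-+ K (λ k → Σ< K (pos (suc k))) (λ k → Σ< K (neg (suc k) ∘ suc)) ⟩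
  Σ< K (λ k → Σ< K (pos (suc k)) + Σ< K (neg (suc k) ∘ suc))
    ≡⟨ Σ<-cong K (λ k _ → S2bar-term-telescopes ℓ (suc k) E 1≤ℓ (s≤s z≤n)) ⟩
  Σ< K (λ k → - hit (+ (suc k ℕ.* suc k)) E (sgn (suc k)))
    ≡⟨ Σ<-neg K (λ k → hit (+ (suc k ℕ.* suc k)) E (sgn (suc k))) ⟩
  - θ⁺ E ∎
  where
  open ≡-Reasoning
  K : ℕ
  K = suc (suc E)
  pos : ℕ → ℕ → ℤ
  pos n j = hit (+ (n ℕ.* n ℕ.+ 2 ℕ.* ℓ ℕ.* n ℕ.+ 2 ℕ.* ℓ ℕ.* n ℕ.* j)) E (sgn n)
  neg : ℕ → ℕ → ℤ
  neg n j = hit (+ (n ℕ.* n) ℤ.- + (2 ℕ.* ℓ ℕ.* n) + + (2 ℕ.* ℓ ℕ.* n ℕ.* j)) E (- sgn n)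
  posSum negSum : ℕ → ℤ
  posSum n = sum (map (pos n) (range E))
  negSum n = sum (map (neg n) (map suc (range E)))

-- Primality of ℓ is only used through ℓ ≥ 1.
lemma2p1 : (ℓ : ℕ) → Prime ℓ → (N : ℕ) →
    + 2 * S2bar ℓ ℓ N ≡ - mul qPoch (inv mqPoch) N + one N
lemma2p1 ℓ ℓ-prime N = begin
  + 2 * S2bar ℓ ℓ N                    ≡⟨ cong (+ 2 *_) (S2bar-ℓ-ℓ ℓ N 1≤ℓ) ⟩
  + 2 * - θ⁺ N                         ≡⟨ rearrange (one N) (θ⁺ N) ⟩
  - (one N + + 2 * θ⁺ N) + one N       ≡⟨ cong (λ x → - x + one N) (θ-coeff N) ⟨
  - θ N + one N                        ≡⟨ cong (λ x → - x + one N) (gauss N) ⟨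
  - mul qPoch (inv mqPoch) N + one N   ∎
  where
  open ≡-Reasoning
  1≤ℓ : 1 ≤ ℓ
  1≤ℓ = ℕP.<⇒≤ (nonTrivial⇒n>1 ℓ {{prime⇒nonTrivial ℓ-prime}})
  rearrange : ∀ a t → + 2 * - t ≡ - (a + + 2 * t) + a
  rearrange = ℤ-solve-∀
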